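{- Let $a+bi \in \mathbb{Z}[i]\setminus\{0\}$ and suppose $\phi_{\mathbb{Z}[i]}(a+bi) = 2k+1$ for an integer $k\geq 0$. Then there exist $u_0,\dots,u_{2k+1} \in \{0,\pm1,\pm i\}$ with $a+bi = \sum_{j=0}^{2k+1} u_j (1+i)^j$ such that the leading term can be chosen as follows, in each case whose condition holds: $u_{2k+1}(1+i)^{2k+1} = 2^k(1+i)$ if $a,b\geq 0$; $u_{2k+1}(1+i)^{2k+1} = -2^k(1+i)$ if $a,b\leq 0$; $u_{2k+1}(1+i)^{2k+1} = 2^k(1-i)$ if $a\geq 0$, $b\leq 0$; $u_{2k+1}(1+i)^{2k+1} = -2^k(1-i)$ if $a \leq 0$, $b\geq 0$.
   Context: For an integral domain $R$, a Euclidean function is a map $f: R\setminus\{0\} \to \mathbb{N}_0$ such that for all $a,b \in R\setminus\{0\}$ there exist $q,r\in R$ with $a = qb+r$ and either $r=0$ or $f(r)<f(b)$. $\phi_{\mathbb{Z}[i]}$ denotes the minimal Euclidean function on the Gaussian integers $\mathbb{Z}[i]$, i.e. the pointwise minimum of all Euclidean functions on $\mathbb{Z}[i]$. An expression $\sum_{j=0}^{n} u_j(1+i)^j$ with $u_j\in\{0,\pm1,\pm i\}$ is called a $(1+i)$-ary expansion of length $n+1$. -}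

module Defs where

open import Data.Nat using (ℕ; zero; suc; _<_; _≤_)
open import Data.Integer as ℤ using (ℤ; +_; -_)
open import Data.Product using (Σ; ∃; _×_; _,_)
open import Data.Sum using (_⊎_)
open import Data.List using (List; []; _∷_)
open import Relation.Binary.PropositionalEquality using (_≡_)
open import Relation.Nullary using (¬_)

record GI : Set where
  constructor _+_i
  field
    re : ℤ
    im : ℤ
open GI public

0G : GI
0G = (+ 0) + (+ 0) i

1G : GI
1G = (+ 1) + (+ 0) i

infixl 6 _⊕_
infixl 7 _⊗_

_⊕_ : GI → GI → GI
(a + b i) ⊕ (c + d i) = (a ℤ.+ c) + (b ℤ.+ d) i

_⊗_ : GI → GI → GI
(a + b i) ⊗ (c + d i) = ((a ℤ.* c) ℤ.- (b ℤ.* d)) + ((a ℤ.* d) ℤ.+ (b ℤ.* c)) i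

_^G_ : GI → ℕ → GI
z ^G zero = 1G
z ^G suc n = z ⊗ (z ^G n)

ω : GI
ω = (+ 1) + (+ 1) i

-- Euclidean function on ℤ[i]: f is only meaningful on nonzero elements
-- (its value at 0 is irrelevant and never used).
IsEuclidean : (GI → ℕ) → Set
IsEuclidean f = ∀ (a b : GI) → ¬ (a ≡ 0G) → ¬ (b ≡ 0G) →
  Σ GI λ q → Σ GI λ r → (a ≡ q ⊗ b ⊕ r) × (r ≡ 0G ⊎ f r < f b)

-- φ_{ℤ[i]}(z) = n, where φ is the pointwise minimum of all Euclidean
-- functions: n is attained by some Euclidean function and is ≤ the
-- value of every Euclidean function at z.
MinEuclidVal : GI → ℕ → Set
MinEuclidVal z n =
  (Σ (GI → ℕ) λ f → IsEuclidean f × f z ≡ n) ×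
  (∀ (g : GI → ℕ) → IsEuclidean g → n ≤ g z)

data Digit : Set where
  d0 d1 d-1 di d-i : Digit

digit : Digit → GI
digit d0  = (+ 0) + (+ 0) i
digit d1  = (+ 1) + (+ 0) i
digit d-1 = (- (+ 1)) + (+ 0) i
digit di  = (+ 0) + (+ 1) i
digit d-i = (+ 0) + (- (+ 1)) i

expandFrom : ℕ → List Digit → GI
expandFrom j [] = 0G
expandFrom j (u ∷ us) = digit u ⊗ (ω ^G j) ⊕ expandFrom (suc j) us

expand : List Digit → GI
expand = expandFrom 0

{-# OPTIONS --safe #-}
-- Write E_n for the Gaussian integers Σ_{j<n} u_j (1+i)^j (Expansion n).  If every residue
-- class modulo z ≠ 0 meets E_n, then z ∈ E_{n+1}: when 1+i divides z, divide and recurse;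
-- otherwise z = 1 + (1+i)w and either N(z) < 2^{n+1}, which already gives z ∈ E_{n+1}, or a
-- representative s ∈ E_n of −w gives (1 + (1+i)q) z = 1 − (1+i)s ∈ E_{n+1}, whose norm bound
-- forces 1 + (1+i)q to be a unit.  So a Euclidean f with f z = 2k+1 puts z in E_{2k+2}; only
-- this, not the minimality of φ, is used.
-- The odd elements of E_n are exactly the points of odd coordinate sum in an octagon
-- |a|, |b| ≤ side n, |a ± b| ≤ diag n.  Comparing the octagons of E_{2k+2} and E_{2k+1} shows
-- z − 2^k(1+i) ∈ E_{2k+1} when re z, im z ≥ 0, and multiplication by i covers the other
-- quadrants.

module Submission where

open import Defs renaming (_+_i to gi)
open import Data.Nat using (ℕ; zero; suc; _^_)
import Data.Nat as ℕ
import Data.Nat.Properties as ℕP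
import Data.Nat.Tactic.RingSolver as ℕSolver
open import Data.Integer as ℤ using (ℤ; +_; -[1+_]; -_; _+_; _*_; _-_; _≤_; +≤+)
import Data.Integer.Properties as ℤP
open ℤP using (≤-reflexive)
open import Data.Integer.DivMod using (_/_; n%d<d; a≡a%n+[a/n]*n)
open import Data.Integer.Tactic.RingSolver using (solve; solve-∀)
import Data.Bool as Bool
open import Data.Empty using (⊥-elim)
open import Data.List using (List; []; _∷_; length; _++_)
open import Data.Product using (Σ; _×_; _,_; proj₁; proj₂)
open import Data.Sum using (_⊎_; inj₁; inj₂) renaming (map to ⊎-map)
open import Relation.Binary.PropositionalEquality
open import Relation.Nullary using (¬_; Dec; yes; no)
open import Relation.Nullary.Decidable using (map′; _×-dec_)

infixl 6 _⊞_
_⊞_ : ∀ {a b c d : ℤ} → a ≤ b → c ≤ d → a + c ≤ b + d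
_⊞_ = ℤP.+-mono-≤

≤-eval : ∀ {i j} {i≤ᵇj : Bool.T (i ℤ.≤ᵇ j)} → i ≤ j
≤-eval {i≤ᵇj = i≤ᵇj} = ℤP.≤ᵇ⇒≤ i≤ᵇj

-- Linear arithmetic: sum the known inequalities into x ≤ y with _⊞_, then
-- check G − H = x − y with the ring solver.
≤-offset : ∀ {x y G H} → x ≤ y → G + y ≡ H + x → G ≤ H
≤-offset {x} {y} {G} {H} x≤y eq = begin
  G          ≡⟨ solve (G ∷ y ∷ []) ⟩
  G + y - y  ≡⟨ cong (_- y) eq ⟩
  H + x - y  ≤⟨ ℤP.+-monoˡ-≤ (- y) (ℤP.+-monoʳ-≤ H x≤y) ⟩
  H + y - y  ≡⟨ solve (H ∷ y ∷ []) ⟩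
  H          ∎
  where open ℤP.≤-Reasoning

0≤ : ∀ n → + 0 ≤ + n
0≤ n = +≤+ ℕ.z≤n

1≰0 : ¬ (+ 1 ≤ + 0)
1≰0 (+≤+ ())

≰⇒suc≤ : ∀ {x y} → ¬ (x ≤ y) → + 1 + y ≤ x
≰⇒suc≤ x≰y = ℤP.i<j⇒suc[i]≤j (ℤP.≰⇒> x≰y)

halve-≤ : ∀ x y → + 2 * x ≤ + 2 * y + + 1 → x ≤ y
halve-≤ x y 2x≤2y+1 = ℤP.≮⇒≥ y≮x
  where
  y≮x : ¬ (y ℤ.< x)
  y≮x y<x = 1≰0 (≤-offset (y+1≤x ⊞ y+1≤x ⊞ 2x≤2y+1) (solve (x ∷ y ∷ [])))
    where
    y+1≤x : + 1 + y ≤ x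
    y+1≤x = ℤP.i<j⇒suc[i]≤j y<x

sector⇒0≤ : ∀ {a b} → b ≤ a → - b ≤ a → + 0 ≤ a
sector⇒0≤ {a} {b} b≤a -b≤a = halve-≤ (+ 0) a (≤-offset (b≤a ⊞ -b≤a ⊞ 0≤ 1) (solve (a ∷ b ∷ [])))

data Parity (x : ℤ) : Set where
  even : ∀ h → x ≡ + 2 * h → Parity x
  odd  : ∀ h → x ≡ + 1 + + 2 * h → Parity x

parity : ∀ x → Parity x
parity x = parity-from (x / + 2) (n%d<d x (+ 2)) (a≡a%n+[a/n]*n x (+ 2))
  where
  parity-from : ∀ {r} q → r ℕ.< 2 → x ≡ + r + q * + 2 → Parity x
  parity-from q (ℕ.s≤s ℕ.z≤n)          x≡ = even q (trans x≡ (solve (q ∷ [])))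
  parity-from q (ℕ.s≤s (ℕ.s≤s ℕ.z≤n)) x≡ = odd q (trans x≡ (solve (q ∷ [])))

even≢odd : ∀ x y → + 2 * x ≢ + 1 + + 2 * y
even≢odd x y e = 1≰0 (≤-offset (y<x ⊞ x≤y) (solve (x ∷ y ∷ [])))
  where
  x≤y : x ≤ y
  x≤y = halve-≤ x y (≤-offset (≤-reflexive e) (solve (x ∷ y ∷ [])))
  y<x : y + + 1 ≤ x
  y<x = halve-≤ (y + + 1) x (≤-offset (≤-reflexive (sym e)) (solve (x ∷ y ∷ [])))

0≤sq : ∀ x → + 0 ≤ x * x
0≤sq (+ n)    = subst (+ 0 ≤_) (ℤP.pos-* n n) (+≤+ ℕ.z≤n)
0≤sq -[1+ n ] = +≤+ ℕ.z≤n

≡0⊎≥1 : ∀ {a} → + 0 ≤ a → a ≡ + 0 ⊎ + 1 ≤ a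
≡0⊎≥1 {+ zero}  _ = inj₁ refl
≡0⊎≥1 {+ suc n} _ = inj₂ (+≤+ (ℕ.s≤s ℕ.z≤n))

+2^suc : ∀ m → + (2 ^ suc m) ≡ + 2 * + (2 ^ m)
+2^suc m = ℤP.pos-* 2 (2 ^ m)

x+y≡s⇒x≡s-y : ∀ {x y s} → x + y ≡ s → x ≡ s - y
x+y≡s⇒x≡s-y {x} {y} {s} x+y≡s = begin
  x          ≡⟨ solve (x ∷ y ∷ []) ⟩
  x + y - y  ≡⟨ cong (_- y) x+y≡s ⟩
  s - y      ∎
  where open ≡-Reasoning

suc≤suc⁻¹ : ∀ {x y} → + 1 + x ≤ y + + 1 → x ≤ y
suc≤suc⁻¹ {x} {y} p = ≤-offset p (solve (x ∷ y ∷ []))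

small-product⇒factor<5 : ∀ {t n p b} → + 0 ≤ n → p ≤ n → t * n ≤ b → b + + 1 ≤ + 5 * p → ¬ (+ 5 ≤ t)
small-product⇒factor<5 {t} {n} {p} {b} 0≤n p≤n tn≤b b<5p 5≤t =
  1≰0 (≤-offset (5p≤5n ⊞ 5n≤tn ⊞ tn≤b ⊞ b<5p) (solve (t ∷ n ∷ p ∷ b ∷ [])))
  where
  5p≤5n : + 5 * p ≤ + 5 * n
  5p≤5n = ℤP.*-monoˡ-≤-nonNeg (+ 5) p≤n
  5n≤tn : + 5 * n ≤ t * n
  5n≤tn = ℤP.*-monoʳ-≤-nonNeg n {{ℤ.nonNegative 0≤n}} 5≤t

mul-i : GI → GI
mul-i (gi a b) = gi (- b) a

neg : GI → GI
neg z = mul-i (mul-i z)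

norm : GI → ℤ
norm (gi a b) = a * a + b * b

⊕-comm : ∀ x y → x ⊕ y ≡ y ⊕ x
⊕-comm (gi a b) (gi c d) = cong₂ gi (ℤP.+-comm a c) (ℤP.+-comm b d)

⊕-assoc : ∀ x y z → (x ⊕ y) ⊕ z ≡ x ⊕ (y ⊕ z)
⊕-assoc (gi a b) (gi c d) (gi e f) = cong₂ gi (ℤP.+-assoc a c e) (ℤP.+-assoc b d f)

⊕-identityˡ : ∀ x → 0G ⊕ x ≡ x
⊕-identityˡ (gi a b) = cong₂ gi (ℤP.+-identityˡ a) (ℤP.+-identityˡ b)

⊕-identityʳ : ∀ x → x ⊕ 0G ≡ x
⊕-identityʳ x = trans (⊕-comm x 0G) (⊕-identityˡ x)

⊗-comm : ∀ x y → x ⊗ y ≡ y ⊗ x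
⊗-comm (gi a b) (gi c d) = cong₂ gi (re-comm a b c d) (im-comm a b c d)
  where
  re-comm : ∀ a b c d → a * c - b * d ≡ c * a - d * b
  re-comm = solve-∀
  im-comm : ∀ a b c d → a * d + b * c ≡ c * b + d * a
  im-comm = solve-∀

⊗-assoc : ∀ x y z → (x ⊗ y) ⊗ z ≡ x ⊗ (y ⊗ z)
⊗-assoc (gi a b) (gi c d) (gi e f) = cong₂ gi (re-assoc a b c d e f) (im-assoc a b c d e f)
  where
  re-assoc : ∀ a b c d e f → (a * c - b * d) * e - (a * d + b * c) * f ≡ a * (c * e - d * f) - b * (c * f + d * e)
  re-assoc = solve-∀
  im-assoc : ∀ a b c d e f → (a * c - b * d) * f + (a * d + b * c) * e ≡ a * (c * f + d * e) + b * (c * e - d * f)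
  im-assoc = solve-∀

⊗-distribˡ-⊕ : ∀ x y z → x ⊗ (y ⊕ z) ≡ x ⊗ y ⊕ x ⊗ z
⊗-distribˡ-⊕ (gi a b) (gi c d) (gi e f) = cong₂ gi (re-distrib a b c d e f) (im-distrib a b c d e f)
  where
  re-distrib : ∀ a b c d e f → a * (c + e) - b * (d + f) ≡ (a * c - b * d) + (a * e - b * f)
  re-distrib = solve-∀
  im-distrib : ∀ a b c d e f → a * (d + f) + b * (c + e) ≡ (a * d + b * c) + (a * f + b * e)
  im-distrib = solve-∀

⊗-distribʳ-⊕ : ∀ x y z → (y ⊕ z) ⊗ x ≡ y ⊗ x ⊕ z ⊗ x
⊗-distribʳ-⊕ x y z = begin
  (y ⊕ z) ⊗ x      ≡⟨ ⊗-comm (y ⊕ z) x ⟩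
  x ⊗ (y ⊕ z)      ≡⟨ ⊗-distribˡ-⊕ x y z ⟩
  x ⊗ y ⊕ x ⊗ z    ≡⟨ cong₂ _⊕_ (⊗-comm x y) (⊗-comm x z) ⟩
  y ⊗ x ⊕ z ⊗ x    ∎
  where open ≡-Reasoning

⊗-identityˡ : ∀ x → 1G ⊗ x ≡ x
⊗-identityˡ (gi a b) = cong₂ gi (re-identity a b) (im-identity a b)
  where
  re-identity : ∀ a b → + 1 * a - + 0 * b ≡ a
  re-identity = solve-∀
  im-identity : ∀ a b → + 1 * b + + 0 * a ≡ b
  im-identity = solve-∀

⊗-zeroˡ : ∀ x → 0G ⊗ x ≡ 0G
⊗-zeroˡ (gi a b) = cong₂ gi (re-zero a b) (im-zero a b)
  where
  re-zero : ∀ a b → + 0 * a - + 0 * b ≡ + 0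
  re-zero = solve-∀
  im-zero : ∀ a b → + 0 * b + + 0 * a ≡ + 0
  im-zero = solve-∀

⊗-zeroʳ : ∀ x → x ⊗ 0G ≡ 0G
⊗-zeroʳ x = trans (⊗-comm x 0G) (⊗-zeroˡ x)

⊗-identityʳ : ∀ x → x ⊗ 1G ≡ x
⊗-identityʳ x = trans (⊗-comm x 1G) (⊗-identityˡ x)

⊗-left-comm : ∀ x y z → x ⊗ (y ⊗ z) ≡ y ⊗ (x ⊗ z)
⊗-left-comm x y z = begin
  x ⊗ (y ⊗ z)  ≡⟨ ⊗-assoc x y z ⟨
  (x ⊗ y) ⊗ z  ≡⟨ cong (_⊗ z) (⊗-comm x y) ⟩
  (y ⊗ x) ⊗ z  ≡⟨ ⊗-assoc y x z ⟩
  y ⊗ (x ⊗ z)  ∎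
  where open ≡-Reasoning

norm-⊗ : ∀ x y → norm (x ⊗ y) ≡ norm x * norm y
norm-⊗ (gi a b) (gi c d) = norm-mul a b c d
  where
  norm-mul : ∀ a b c d → (a * c - b * d) * (a * c - b * d) + (a * d + b * c) * (a * d + b * c)
                         ≡ (a * a + b * b) * (c * c + d * d)
  norm-mul = solve-∀

mul-i-≢0 : ∀ {z} → z ≢ 0G → mul-i z ≢ 0G
mul-i-≢0 {gi a b} z≢0 iz≡0 = z≢0 (cong₂ gi (cong im iz≡0) (ℤP.neg-injective (cong re iz≡0)))

mul-i^ : ℕ → GI → GI
mul-i^ zero    z = z
mul-i^ (suc t) z = mul-i (mul-i^ t z)

mul-i^4 : ∀ z → mul-i^ 4 z ≡ z
mul-i^4 (gi a b) = cong₂ gi (ℤP.neg-involutive a) (ℤP.neg-involutive b)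

mul-i^-≢0 : ∀ t {z} → z ≢ 0G → mul-i^ t z ≢ 0G
mul-i^-≢0 zero    z≢0 = z≢0
mul-i^-≢0 (suc t) z≢0 = mul-i-≢0 (mul-i^-≢0 t z≢0)

mul-i-⊕ : ∀ x y → mul-i x ⊕ mul-i y ≡ mul-i (x ⊕ y)
mul-i-⊕ (gi a b) (gi c d) = cong₂ gi (sym (ℤP.neg-distrib-+ b d)) refl

ω-mul : ∀ p q → ω ⊗ gi p q ≡ gi (p - q) (p + q)
ω-mul p q = cong₂ gi (cong₂ _-_ (ℤP.*-identityˡ p) (ℤP.*-identityˡ q))
                     (trans (cong₂ _+_ (ℤP.*-identityˡ q) (ℤP.*-identityˡ p)) (ℤP.+-comm q p))

horner-step : ∀ x y p q → gi x y ⊕ ω ⊗ gi p q ≡ gi (x + (p - q)) (y + (p + q))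
horner-step x y p q = cong (gi x y ⊕_) (ω-mul p q)

horner-from : ∀ {a b} x y p q → a ≡ x + (p - q) → b ≡ y + (p + q) → gi a b ≡ gi x y ⊕ ω ⊗ gi p q
horner-from x y p q a≡ b≡ = trans (cong₂ gi a≡ b≡) (sym (horner-step x y p q))

horner-absorb : ∀ d s q w → (d ⊕ ω ⊗ s) ⊕ q ⊗ (ω ⊗ w) ≡ d ⊕ ω ⊗ (s ⊕ q ⊗ w)
horner-absorb d s q w = begin
  (d ⊕ ω ⊗ s) ⊕ q ⊗ (ω ⊗ w)     ≡⟨ ⊕-assoc d (ω ⊗ s) (q ⊗ (ω ⊗ w)) ⟩
  d ⊕ (ω ⊗ s ⊕ q ⊗ (ω ⊗ w))     ≡⟨ cong (λ u → d ⊕ (ω ⊗ s ⊕ u)) (⊗-left-comm q ω w) ⟩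
  d ⊕ (ω ⊗ s ⊕ ω ⊗ (q ⊗ w))     ≡⟨ cong (d ⊕_) (⊗-distribˡ-⊕ ω s (q ⊗ w)) ⟨
  d ⊕ ω ⊗ (s ⊕ q ⊗ w)           ∎
  where open ≡-Reasoning

0≤norm : ∀ z → + 0 ≤ norm z
0≤norm (gi a b) = 0≤sq a ⊞ 0≤sq b

_≟ᴳ_ : (x y : GI) → Dec (x ≡ y)
gi a b ≟ᴳ gi c d = map′ (λ (a≡c , b≡d) → cong₂ gi a≡c b≡d) (λ e → cong re e , cong im e) ((a ℤP.≟ c) ×-dec (b ℤP.≟ d))

-- Expansions in base 1+i

data Expansion : ℕ → GI → Set where
  []ᵉ  : Expansion 0 0G
  _∷ᵉ_ : ∀ {n z} (d : Digit) → Expansion n z → Expansion (suc n) (digit d ⊕ ω ⊗ z)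

uncons : ∀ {n x} → Expansion (suc n) x →
  Σ Digit λ d → Σ GI λ z → Expansion n z × x ≡ digit d ⊕ ω ⊗ z
uncons (d ∷ᵉ s) = d , _ , s , refl

expansion-0 : ∀ n → Expansion n 0G
expansion-0 zero    = []ᵉ
expansion-0 (suc n) = d0 ∷ᵉ expansion-0 n

Expansion₀⇒≡0 : ∀ {z} → Expansion 0 z → z ≡ 0G
Expansion₀⇒≡0 []ᵉ = refl

infixl 7 _·ᵈ_
_·ᵈ_ : Digit → Digit → Digit
d0  ·ᵈ _   = d0
d1  ·ᵈ d   = d
_   ·ᵈ d0  = d0
di  ·ᵈ d1  = di
di  ·ᵈ di  = d-1
di  ·ᵈ d-1 = d-i
di  ·ᵈ d-i = d1
d-1 ·ᵈ d1  = d-1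
d-1 ·ᵈ di  = d-i
d-1 ·ᵈ d-1 = d1
d-1 ·ᵈ d-i = di
d-i ·ᵈ d1  = d-i
d-i ·ᵈ di  = d1
d-i ·ᵈ d-1 = di
d-i ·ᵈ d-i = d-1

digit-·ᵈ : ∀ u d → digit (u ·ᵈ d) ≡ digit u ⊗ digit d
digit-·ᵈ d0  d0  = refl
digit-·ᵈ d0  d1  = refl
digit-·ᵈ d0  d-1 = refl
digit-·ᵈ d0  di  = refl
digit-·ᵈ d0  d-i = refl
digit-·ᵈ d1  d0  = refl
digit-·ᵈ d1  d1  = refl
digit-·ᵈ d1  d-1 = refl
digit-·ᵈ d1  di  = refl
digit-·ᵈ d1  d-i = refl
digit-·ᵈ d-1 d0  = refl
digit-·ᵈ d-1 d1  = refl
digit-·ᵈ d-1 d-1 = refl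
digit-·ᵈ d-1 di  = refl
digit-·ᵈ d-1 d-i = refl
digit-·ᵈ di  d0  = refl
digit-·ᵈ di  d1  = refl
digit-·ᵈ di  d-1 = refl
digit-·ᵈ di  di  = refl
digit-·ᵈ di  d-i = refl
digit-·ᵈ d-i d0  = refl
digit-·ᵈ d-i d1  = refl
digit-·ᵈ d-i d-1 = refl
digit-·ᵈ d-i di  = refl
digit-·ᵈ d-i d-i = refl

Expansion-digit-⊗ : ∀ u {n z} → Expansion n z → Expansion n (digit u ⊗ z)
Expansion-digit-⊗ u []ᵉ = subst (Expansion 0) (sym (⊗-zeroʳ (digit u))) []ᵉ
Expansion-digit-⊗ u (_∷ᵉ_ {z = z} d s) = subst (Expansion _) horner ((u ·ᵈ d) ∷ᵉ Expansion-digit-⊗ u s)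
  where
  horner : digit (u ·ᵈ d) ⊕ ω ⊗ (digit u ⊗ z) ≡ digit u ⊗ (digit d ⊕ ω ⊗ z)
  horner = begin
    digit (u ·ᵈ d) ⊕ ω ⊗ (digit u ⊗ z)     ≡⟨ cong₂ _⊕_ (digit-·ᵈ u d) (⊗-left-comm ω (digit u) z) ⟩
    digit u ⊗ digit d ⊕ digit u ⊗ (ω ⊗ z)  ≡⟨ ⊗-distribˡ-⊕ (digit u) (digit d) (ω ⊗ z) ⟨
    digit u ⊗ (digit d ⊕ ω ⊗ z)            ∎
    where open ≡-Reasoning

digit-i⊗ : ∀ z → digit di ⊗ z ≡ mul-i z
digit-i⊗ (gi a b) = cong₂ gi (re-i a b) (im-i a b)
  where
  re-i : ∀ a b → + 0 * a - + 1 * b ≡ - b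
  re-i = solve-∀
  im-i : ∀ a b → + 0 * b + + 1 * a ≡ a
  im-i = solve-∀

Expansion-mul-i : ∀ {n z} → Expansion n z → Expansion n (mul-i z)
Expansion-mul-i {z = z} s = subst (Expansion _) (digit-i⊗ z) (Expansion-digit-⊗ di s)

Expansion-neg : ∀ {n z} → Expansion n z → Expansion n (neg z)
Expansion-neg s = Expansion-mul-i (Expansion-mul-i s)

Expansion-mul-i^ : ∀ t {n z} → Expansion n z → Expansion n (mul-i^ t z)
Expansion-mul-i^ zero    s = s
Expansion-mul-i^ (suc t) s = Expansion-mul-i (Expansion-mul-i^ t s)

-- The octagon containing the expansions of length n

record Octagon (M T a b : ℤ) : Set where
  field
    a≤    : a ≤ M
    -a≤   : - a ≤ M
    b≤    : b ≤ M
    -b≤   : - b ≤ M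
    a+b≤  : a + b ≤ T
    a-b≤  : a - b ≤ T
    -a+b≤ : - a + b ≤ T
    -a-b≤ : - a - b ≤ T

digit-octagon : ∀ d → Octagon (+ 1) (+ 1) (re (digit d)) (im (digit d))
digit-octagon d0  = record { a≤ = ≤-eval ; -a≤ = ≤-eval ; b≤ = ≤-eval ; -b≤ = ≤-eval
                           ; a+b≤ = ≤-eval ; a-b≤ = ≤-eval ; -a+b≤ = ≤-eval ; -a-b≤ = ≤-eval }
digit-octagon d1  = record { a≤ = ≤-eval ; -a≤ = ≤-eval ; b≤ = ≤-eval ; -b≤ = ≤-eval
                           ; a+b≤ = ≤-eval ; a-b≤ = ≤-eval ; -a+b≤ = ≤-eval ; -a-b≤ = ≤-eval }
digit-octagon d-1 = record { a≤ = ≤-eval ; -a≤ = ≤-eval ; b≤ = ≤-eval ; -b≤ = ≤-eval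
                           ; a+b≤ = ≤-eval ; a-b≤ = ≤-eval ; -a+b≤ = ≤-eval ; -a-b≤ = ≤-eval }
digit-octagon di  = record { a≤ = ≤-eval ; -a≤ = ≤-eval ; b≤ = ≤-eval ; -b≤ = ≤-eval
                           ; a+b≤ = ≤-eval ; a-b≤ = ≤-eval ; -a+b≤ = ≤-eval ; -a-b≤ = ≤-eval }
digit-octagon d-i = record { a≤ = ≤-eval ; -a≤ = ≤-eval ; b≤ = ≤-eval ; -b≤ = ≤-eval
                           ; a+b≤ = ≤-eval ; a-b≤ = ≤-eval ; -a+b≤ = ≤-eval ; -a-b≤ = ≤-eval }

octagon-horner : ∀ {M T x y p q} → Octagon (+ 1) (+ 1) x y → Octagon M T p q →
  Octagon (+ 1 + T) (+ 1 + (M + M)) (x + (p - q)) (y + (p + q))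
octagon-horner {M} {T} {x} {y} {p} {q} D O = record
  { a≤    = ≤-offset (D.a≤ ⊞ O.a-b≤) (solve (x ∷ y ∷ p ∷ q ∷ M ∷ T ∷ []))
  ; -a≤   = ≤-offset (D.-a≤ ⊞ O.-a+b≤) (solve (x ∷ y ∷ p ∷ q ∷ M ∷ T ∷ []))
  ; b≤    = ≤-offset (D.b≤ ⊞ O.a+b≤) (solve (x ∷ y ∷ p ∷ q ∷ M ∷ T ∷ []))
  ; -b≤   = ≤-offset (D.-b≤ ⊞ O.-a-b≤) (solve (x ∷ y ∷ p ∷ q ∷ M ∷ T ∷ []))
  ; a+b≤  = ≤-offset (D.a+b≤ ⊞ O.a≤ ⊞ O.a≤) (solve (x ∷ y ∷ p ∷ q ∷ M ∷ T ∷ []))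
  ; a-b≤  = ≤-offset (D.a-b≤ ⊞ O.-b≤ ⊞ O.-b≤) (solve (x ∷ y ∷ p ∷ q ∷ M ∷ T ∷ []))
  ; -a+b≤ = ≤-offset (D.-a+b≤ ⊞ O.b≤ ⊞ O.b≤) (solve (x ∷ y ∷ p ∷ q ∷ M ∷ T ∷ []))
  ; -a-b≤ = ≤-offset (D.-a-b≤ ⊞ O.-a≤ ⊞ O.-a≤) (solve (x ∷ y ∷ p ∷ q ∷ M ∷ T ∷ []))
  }
  where
  module D = Octagon D
  module O = Octagon O

octagon-mul-i : ∀ {M T a b} → Octagon M T a b → Octagon M T (- b) a
octagon-mul-i {M} {T} {a} {b} O = record
  { a≤ = O.-b≤ ; -a≤ = ≤-offset O.b≤ (solve (b ∷ M ∷ [])) ; b≤ = O.a≤ ; -b≤ = O.-a≤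
  ; a+b≤  = ≤-offset O.a-b≤ (solve (a ∷ b ∷ T ∷ []))
  ; a-b≤  = ≤-offset O.-a-b≤ (solve (a ∷ b ∷ T ∷ []))
  ; -a+b≤ = ≤-offset O.a+b≤ (solve (a ∷ b ∷ T ∷ []))
  ; -a-b≤ = ≤-offset O.-a+b≤ (solve (a ∷ b ∷ T ∷ []))
  }
  where module O = Octagon O

octagon-mul-i⁻¹ : ∀ {M T a b} → Octagon M T (- b) a → Octagon M T a b
octagon-mul-i⁻¹ {M} {T} {a} {b} O =
  subst₂ (Octagon M T) (ℤP.neg-involutive a) (ℤP.neg-involutive b)
    (octagon-mul-i (octagon-mul-i (octagon-mul-i O)))

side diag : ℕ → ℕ
side zero    = 0
side (suc n) = suc (diag n)
diag zero    = 0
diag (suc n) = suc (side n ℕ.+ side n)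

side≤diag≤2side : ∀ n → side n ℕ.≤ diag n × diag n ℕ.≤ side n ℕ.+ side n
side≤diag≤2side zero = ℕ.z≤n , ℕ.z≤n
side≤diag≤2side (suc n) with side≤diag≤2side n
... | s≤d , d≤2s = ℕ.s≤s d≤2s , ℕ.s≤s (ℕP.+-mono-≤ s≤d (ℕP.m≤n⇒m≤1+n s≤d))

Oct : ℕ → ℤ → ℤ → Set
Oct n = Octagon (+ side n) (+ diag n)

expansion-octagon : ∀ {n z} → Expansion n z → Oct n (re z) (im z)
expansion-octagon []ᵉ = record { a≤ = ≤-eval ; -a≤ = ≤-eval ; b≤ = ≤-eval ; -b≤ = ≤-eval
                               ; a+b≤ = ≤-eval ; a-b≤ = ≤-eval ; -a+b≤ = ≤-eval ; -a-b≤ = ≤-eval }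
expansion-octagon (_∷ᵉ_ {z = z} d s) =
  subst₂ (Oct _) (cong re (sym step)) (cong im (sym step))
    (octagon-horner (digit-octagon d) (expansion-octagon s))
  where
  step : digit d ⊕ ω ⊗ z ≡ gi (re (digit d) + (re z - im z)) (im (digit d) + (re z + im z))
  step = horner-step (re (digit d)) (im (digit d)) (re z) (im z)

by-quarter-turns : (P : ℤ → ℤ → Set) → (∀ {a b} → P a b → P (- b) a) →
  (∀ a b → b ≤ a → - b ≤ a → P a b) → ∀ a b → P a b
by-quarter-turns P turn sector a b = by-sector (ℤP.≤-total b a) (ℤP.≤-total (- b) a)
  where
  turn⁻¹ : ∀ {x y} → P y (- x) → P x y
  turn⁻¹ {x} {y} p = subst (λ u → P u y) (ℤP.neg-involutive x) (turn p)

  by-sector : b ≤ a ⊎ a ≤ b → - b ≤ a ⊎ a ≤ - b → P a b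
  by-sector (inj₁ b≤a) (inj₁ -b≤a) = sector a b b≤a -b≤a
  by-sector (inj₁ b≤a) (inj₂ a≤-b) =
    turn⁻¹ (turn⁻¹ (turn⁻¹ (subst (P (- b)) (sym (ℤP.neg-involutive a))
      (sector (- b) a (≤-offset a≤-b (solve (a ∷ b ∷ []))) (≤-offset b≤a (solve (a ∷ b ∷ [])))))))
  by-sector (inj₂ a≤b) (inj₁ -b≤a) =
    turn⁻¹ (sector b (- a) (≤-offset -b≤a (solve (a ∷ b ∷ []))) (≤-offset a≤b (solve (a ∷ b ∷ []))))
  by-sector (inj₂ a≤b) (inj₂ a≤-b) =
    turn⁻¹ (turn⁻¹ (sector (- a) (- b) (≤-offset a≤b (solve (a ∷ b ∷ []))) (≤-offset a≤-b
        (solve (a ∷ b ∷ [])))))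

record DigitPeel (A B a b : ℤ) : Set where
  field
    d       : Digit
    p q h   : ℤ
    p+q-odd : p + q ≡ + 1 + + 2 * h
    octagon : Octagon (+ 1 + B) (+ 1 + (A + A)) p q
    horner  : gi a b ≡ digit d ⊕ ω ⊗ gi p q

-- For A = side n and B = diag n, O is the octagon of E_{n+2} and the quotient lands in that of
-- E_{n+1}.  The digit is 1 when a is even and ±i (by the sign of b) when a is odd; in each case
-- the quotient by 1+i again has odd coordinate sum.
module Peel (A B a b h : ℤ) (A≤B : A ≤ B) (0≤A : + 0 ≤ A) (b≤a : b ≤ a) (-b≤a : - b ≤ a)
            (a+b≡ : a + b ≡ + 1 + + 2 * h)
            (O : Octagon (+ 2 + (A + A)) (+ 1 + ((+ 1 + B) + (+ 1 + B))) a b) where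
  private module O = Octagon O

  0≤B : + 0 ≤ B
  0≤B = ℤP.≤-trans 0≤A A≤B

  0≤a : + 0 ≤ a
  0≤a = sector⇒0≤ b≤a -b≤a

  a≡ : a ≡ + 1 + + 2 * h - b
  a≡ = x+y≡s⇒x≡s-y a+b≡

  peel-1 : ∀ g → a ≡ + 2 * g → DigitPeel A B a b
  peel-1 g a≡2g = record
    { d = d1 ; p = h ; q = b - h ; h = h - g
    ; p+q-odd = begin
        h + (b - h)               ≡⟨ solve (a ∷ b ∷ h ∷ []) ⟩
        (a + b) - a               ≡⟨ cong₂ _-_ a+b≡ a≡2g ⟩
        (+ 1 + + 2 * h) - + 2 * g ≡⟨ solve (h ∷ g ∷ []) ⟩
        + 1 + + 2 * (h - g)       ∎
    ; octagon = record
      { a≤    = halve-≤ h (+ 1 + B) (≤-offset (≤-reflexive (sym a+b≡) ⊞ O.a+b≤ ⊞ 0≤ 1)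
            (solve (a ∷ b ∷ h ∷ B ∷ [])))
      ; -a≤   = halve-≤ (- h) (+ 1 + B) (≤-offset (≤-reflexive a+b≡ ⊞ -b≤a ⊞ 0≤B ⊞ 0≤B ⊞ 0≤ 2)
            (solve (a ∷ b ∷ h ∷ B ∷ [])))
      ; b≤    = halve-≤ (b - h) (+ 1 + B) (≤-offset (≤-reflexive a+b≡ ⊞ b≤a ⊞ 0≤B ⊞ 0≤B ⊞ 0≤ 2)
            (solve (a ∷ b ∷ h ∷ B ∷ [])))
      ; -b≤   = halve-≤ (- (b - h)) (+ 1 + B) (≤-offset (≤-reflexive (sym a+b≡) ⊞ O.a-b≤ ⊞ 0≤ 1)
            (solve (a ∷ b ∷ h ∷ B ∷ [])))
      ; a+b≤  = ≤-offset (h-g≤A ⊞ h-g≤A ⊞ ≤-reflexive a+b≡ ⊞ ≤-reflexive (sym a≡2g))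
            (solve (a ∷ b ∷ h ∷ g ∷ A ∷ []))
      ; a-b≤  = ≤-offset (≤-reflexive (sym a+b≡) ⊞ O.a≤) (solve (a ∷ b ∷ h ∷ A ∷ []))
      ; -a+b≤ = ≤-offset (≤-reflexive a+b≡ ⊞ 0≤a ⊞ 0≤A ⊞ 0≤A) (solve (a ∷ b ∷ h ∷ A ∷ []))
      ; -a-b≤ = ≤-offset (g-h-1≤A ⊞ g-h-1≤A ⊞ ≤-reflexive (sym a+b≡) ⊞ ≤-reflexive a≡2g)
            (solve (a ∷ b ∷ h ∷ g ∷ A ∷ []))
      }
    ; horner = horner-from (+ 1) (+ 0) h (b - h) (trans a≡ (solve (b ∷ h ∷ []))) (solve (b ∷ h ∷ []))
    }
    where
    open ≡-Reasoning
    h-g≤A : h - g ≤ A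
    h-g≤A = halve-≤ (h - g) A (≤-offset (≤-reflexive (sym a+b≡) ⊞ ≤-reflexive a≡2g ⊞ b≤a ⊞ O.a≤)
        (solve (a ∷ b ∷ h ∷ g ∷ A ∷ [])))
    g-h-1≤A : g - h - + 1 ≤ A
    g-h-1≤A = halve-≤ (g - h - + 1) A (≤-offset (≤-reflexive (sym a≡2g) ⊞ ≤-reflexive a+b≡ ⊞ -b≤a ⊞ O.a≤)
        (solve (a ∷ b ∷ h ∷ g ∷ A ∷ [])))

  module _ (g : ℤ) (a≡2g+1 : a ≡ + 1 + + 2 * g) where
    a≤2A+1 : a ≤ + 1 + (A + A)
    a≤2A+1 = ≤-offset (≤-reflexive a≡2g+1 ⊞ g≤A ⊞ g≤A) (solve (a ∷ g ∷ A ∷ []))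
      where
      g≤A : g ≤ A
      g≤A = halve-≤ g A (≤-offset (≤-reflexive (sym a≡2g+1) ⊞ O.a≤) (solve (a ∷ g ∷ A ∷ [])))

    peel-i : + 0 ≤ b → DigitPeel A B a b
    peel-i 0≤b = record
      { d = di ; p = h ; q = b - + 1 - h ; h = h - g - + 1
      ; p+q-odd = begin
          h + (b - + 1 - h)                        ≡⟨ solve (a ∷ b ∷ h ∷ []) ⟩
          (a + b) - a - + 1                        ≡⟨ cong (_- + 1) (cong₂ _-_ a+b≡ a≡2g+1) ⟩
          (+ 1 + + 2 * h) - (+ 1 + + 2 * g) - + 1  ≡⟨ solve (h ∷ g ∷ []) ⟩
          + 1 + + 2 * (h - g - + 1)                ∎
      ; octagon = record
        { a≤    = halve-≤ h (+ 1 + B) (≤-offset (≤-reflexive (sym a+b≡) ⊞ O.a+b≤ ⊞ 0≤ 1)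
              (solve (a ∷ b ∷ h ∷ B ∷ [])))
        ; -a≤   = halve-≤ (- h) (+ 1 + B) (≤-offset (≤-reflexive a+b≡ ⊞ -b≤a ⊞ 0≤B ⊞ 0≤B ⊞ 0≤ 2)
              (solve (a ∷ b ∷ h ∷ B ∷ [])))
        ; b≤    = halve-≤ (b - + 1 - h) (+ 1 + B) (≤-offset (≤-reflexive a+b≡ ⊞ b≤a ⊞ 0≤B ⊞ 0≤B ⊞ 0≤ 4)
              (solve (a ∷ b ∷ h ∷ B ∷ [])))
        ; -b≤   = halve-≤ (- (b - + 1 - h)) (+ 1 + B) (≤-offset (≤-reflexive (sym a+b≡) ⊞ 0≤b ⊞ a≤2A+1 ⊞ A≤B ⊞ A≤B ⊞ 0≤ 1)
              (solve (a ∷ b ∷ h ∷ A ∷ B ∷ [])))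
        ; a+b≤  = ≤-offset (b≤a ⊞ a≤2A+1 ⊞ 0≤ 1) (solve (a ∷ b ∷ h ∷ A ∷ []))
        ; a-b≤  = ≤-offset (≤-reflexive (sym a+b≡) ⊞ a≤2A+1) (solve (a ∷ b ∷ h ∷ A ∷ []))
        ; -a+b≤ = ≤-offset (≤-reflexive a+b≡ ⊞ 0≤a ⊞ 0≤A ⊞ 0≤A ⊞ 0≤ 1) (solve (a ∷ b ∷ h ∷ A ∷ []))
        ; -a-b≤ = ≤-offset (0≤b ⊞ 0≤A ⊞ 0≤A) (solve (a ∷ b ∷ h ∷ A ∷ []))
        }
      ; horner = horner-from (+ 0) (+ 1) h (b - + 1 - h) (trans a≡ (solve (b ∷ h ∷ []))) (solve (b ∷ h ∷ []))
      }
      where open ≡-Reasoning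

    peel-minus-i : ¬ (+ 0 ≤ b) → DigitPeel A B a b
    peel-minus-i 0≰b = record
      { d = d-i ; p = h + + 1 ; q = b - h ; h = h - g
      ; p+q-odd = begin
          (h + + 1) + (b - h)                      ≡⟨ solve (a ∷ b ∷ h ∷ []) ⟩
          (a + b) - a + + 1                        ≡⟨ cong (_+ + 1) (cong₂ _-_ a+b≡ a≡2g+1) ⟩
          (+ 1 + + 2 * h) - (+ 1 + + 2 * g) + + 1  ≡⟨ solve (h ∷ g ∷ []) ⟩
          + 1 + + 2 * (h - g)                      ∎
      ; octagon = record
        { a≤    = halve-≤ (h + + 1) (+ 1 + B) (≤-offset (≤-reflexive (sym a+b≡) ⊞ b+1≤0 ⊞ a≤2A+1 ⊞ A≤B ⊞ A≤B ⊞ 0≤ 2)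
              (solve (a ∷ b ∷ h ∷ A ∷ B ∷ [])))
        ; -a≤   = halve-≤ (- (h + + 1)) (+ 1 + B) (≤-offset (≤-reflexive a+b≡ ⊞ -b≤a ⊞ 0≤B ⊞ 0≤B ⊞ 0≤ 4)
              (solve (a ∷ b ∷ h ∷ B ∷ [])))
        ; b≤    = halve-≤ (b - h) (+ 1 + B) (≤-offset (≤-reflexive a+b≡ ⊞ b≤a ⊞ 0≤B ⊞ 0≤B ⊞ 0≤ 2)
              (solve (a ∷ b ∷ h ∷ B ∷ [])))
        ; -b≤   = halve-≤ (- (b - h)) (+ 1 + B) (≤-offset (≤-reflexive (sym a+b≡) ⊞ O.a-b≤ ⊞ 0≤ 1)
              (solve (a ∷ b ∷ h ∷ B ∷ [])))
        ; a+b≤  = ≤-offset (b+1≤0 ⊞ 0≤A ⊞ 0≤A ⊞ 0≤ 1) (solve (a ∷ b ∷ h ∷ A ∷ []))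
        ; a-b≤  = ≤-offset (≤-reflexive (sym a+b≡) ⊞ a≤2A+1) (solve (a ∷ b ∷ h ∷ A ∷ []))
        ; -a+b≤ = ≤-offset (≤-reflexive a+b≡ ⊞ 0≤a ⊞ 0≤A ⊞ 0≤A ⊞ 0≤ 1) (solve (a ∷ b ∷ h ∷ A ∷ []))
        ; -a-b≤ = ≤-offset (-b≤a ⊞ a≤2A+1 ⊞ 0≤ 1) (solve (a ∷ b ∷ h ∷ A ∷ []))
        }
      ; horner = horner-from (+ 0) (- (+ 1)) (h + + 1) (b - h) (trans a≡ (solve (b ∷ h ∷ [])))
            (solve (b ∷ h ∷ []))
      }
      where
      open ≡-Reasoning
      b+1≤0 : + 1 + b ≤ + 0
      b+1≤0 = ≰⇒suc≤ 0≰b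

  peel : DigitPeel A B a b
  peel with parity a | + 0 ℤP.≤? b
  ... | even g a≡2g   | _         = peel-1 g a≡2g
  ... | odd g a≡2g+1  | yes 0≤b   = peel-i g a≡2g+1 0≤b
  ... | odd g a≡2g+1  | no 0≰b    = peel-minus-i g a≡2g+1 0≰b

odd-octagon⇒expansion : ∀ n a b h → a + b ≡ + 1 + + 2 * h → Oct (suc n) a b → Expansion (suc n) (gi a b)
odd-octagon⇒expansion-sector : ∀ n a b → b ≤ a → - b ≤ a →
  ∀ h → a + b ≡ + 1 + + 2 * h → Oct (suc n) a b → Expansion (suc n) (gi a b)

odd-octagon⇒expansion n = by-quarter-turns _ turn (odd-octagon⇒expansion-sector n)
  where
  turn : ∀ {a b} → (∀ h → a + b ≡ + 1 + + 2 * h → Oct (suc n) a b → Expansion (suc n) (gi a b)) →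
    ∀ h → - b + a ≡ + 1 + + 2 * h → Oct (suc n) (- b) a → Expansion (suc n) (gi (- b) a)
  turn {a} {b} expands h -b+a≡ O = Expansion-mul-i (expands (h + b) a+b≡ (octagon-mul-i⁻¹ O))
    where
    a+b≡ : a + b ≡ + 1 + + 2 * (h + b)
    a+b≡ = begin
      a + b                     ≡⟨ solve (a ∷ b ∷ []) ⟩
      (- b + a) + + 2 * b       ≡⟨ cong (_+ + 2 * b) -b+a≡ ⟩
      (+ 1 + + 2 * h) + + 2 * b ≡⟨ solve (b ∷ h ∷ []) ⟩
      + 1 + + 2 * (h + b)       ∎
      where open ≡-Reasoning

odd-octagon⇒expansion-sector zero a b b≤a -b≤a h a+b≡ O =
  subst (Expansion 1) (cong₂ gi (sym a≡1) (sym b≡0)) (d1 ∷ᵉ []ᵉ)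
  where
  module O = Octagon O
  b≡0 : b ≡ + 0
  b≡0 = ℤP.≤-antisym (halve-≤ b (+ 0) (≤-offset (b≤a ⊞ O.a+b≤) (solve (a ∷ b ∷ []))))
                     (≤-offset (halve-≤ (- b) (+ 0) (≤-offset (-b≤a ⊞ O.a-b≤) (solve (a ∷ b ∷ []))))
                         (solve (b ∷ [])))
  0≤a : + 0 ≤ a
  0≤a = sector⇒0≤ b≤a -b≤a
  h≡0 : h ≡ + 0
  h≡0 = ℤP.≤-antisym
    (halve-≤ h (+ 0) (≤-offset (≤-reflexive (sym a+b≡) ⊞ O.a≤ ⊞ ≤-reflexive b≡0 ⊞ 0≤ 1)
        (solve (a ∷ b ∷ h ∷ []))))
    (≤-offset (halve-≤ (- h) (+ 0) (≤-offset (≤-reflexive a+b≡ ⊞ 0≤a ⊞ ≤-reflexive (sym b≡0)) (solve (a ∷ b ∷ h ∷ []))))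
        (solve (h ∷ [])))
  a≡1 : a ≡ + 1
  a≡1 = begin
    a                   ≡⟨ x+y≡s⇒x≡s-y a+b≡ ⟩
    (+ 1 + + 2 * h) - b ≡⟨ cong₂ (λ u v → (+ 1 + + 2 * u) - v) h≡0 b≡0 ⟩
    + 1                 ∎
    where open ≡-Reasoning
odd-octagon⇒expansion-sector (suc n) a b b≤a -b≤a h a+b≡ O =
  subst (Expansion _) (sym horner) (d ∷ᵉ odd-octagon⇒expansion n p q h′ p+q-odd octagon)
  where
  open DigitPeel (Peel.peel (+ side n) (+ diag n) a b h (+≤+ (proj₁ (side≤diag≤2side n))) (0≤ _) b≤a -b≤a a+b≡ O)
    renaming (h to h′)

-- Elements of small norm

even-norm-halves : ∀ h b P → (+ 2 * h - b) * (+ 2 * h - b) + b * b + + 1 ≤ + 2 * P →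
  h * h + (b - h) * (b - h) + + 1 ≤ P
even-norm-halves h b P small = halve-≤ _ P (≤-offset small (solve (h ∷ b ∷ P ∷ [])))

odd-norm-halves : ∀ h b P → + 1 ≤ + 1 + + 2 * h - b →
  (+ 1 + + 2 * h - b) * (+ 1 + + 2 * h - b) + b * b + + 1 ≤ + 2 * P → h * h + (b - h) * (b - h) + + 1 ≤ P
odd-norm-halves h b P 1≤a small = halve-≤ _ P (≤-offset (small ⊞ 1≤a ⊞ 1≤a ⊞ 0≤ 1) (solve (h ∷ b ∷ P ∷ [])))

small-norm⇒expansion : ∀ m a b → a * a + b * b + + 1 ≤ + (2 ^ m) → Expansion m (gi a b)
small-norm⇒expansion-sector : ∀ m a b → b ≤ a → - b ≤ a → a * a + b * b + + 1 ≤ + (2 ^ m) →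
  Expansion m (gi a b)

small-norm⇒expansion m = by-quarter-turns _ turn (small-norm⇒expansion-sector m)
  where
  turn : ∀ {a b} → (a * a + b * b + + 1 ≤ + (2 ^ m) → Expansion m (gi a b)) →
    - b * - b + a * a + + 1 ≤ + (2 ^ m) → Expansion m (gi (- b) a)
  turn {a} {b} expands small = Expansion-mul-i (expands (≤-offset small (solve (a ∷ b ∷ []))))

small-norm⇒expansion-sector m a b b≤a -b≤a small = by-sign (≡0⊎≥1 0≤a)
  where
  0≤a : + 0 ≤ a
  0≤a = sector⇒0≤ b≤a -b≤a

  by-sign : a ≡ + 0 ⊎ + 1 ≤ a → Expansion m (gi a b)
  by-sign (inj₁ a≡0) = subst (Expansion m) (cong₂ gi (sym a≡0) (sym b≡0)) (expansion-0 m)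
    where
    b≡0 : b ≡ + 0
    b≡0 = ℤP.≤-antisym (subst (b ≤_) a≡0 b≤a) (≤-offset (subst (- b ≤_) a≡0 -b≤a) (solve (b ∷ [])))
  by-sign (inj₂ 1≤a) = positive m small
    where
    positive : ∀ m → a * a + b * b + + 1 ≤ + (2 ^ m) → Expansion m (gi a b)
    positive zero small = ⊥-elim (1≰0 (≤-offset (small ⊞ 1≤a² ⊞ 0≤sq b) (solve (a ∷ b ∷ []))))
      where
      1≤a² : + 1 ≤ a * a
      1≤a² = ℤP.≤-trans 1≤a (subst (_≤ a * a) (ℤP.*-identityˡ a)
               (ℤP.*-monoʳ-≤-nonNeg a {{ℤ.nonNegative 0≤a}} 1≤a))
    positive (suc m) small = by-parity (parity (a + b))
      where
      by-parity : Parity (a + b) → Expansion (suc m) (gi a b)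
      by-parity (even h a+b≡2h) = subst (Expansion (suc m)) (sym horner)
          (d0 ∷ᵉ small-norm⇒expansion m h (b - h) (even-norm-halves h b _ small′))
        where
        a≡ : a ≡ + 2 * h - b
        a≡ = x+y≡s⇒x≡s-y a+b≡2h
        small′ : (+ 2 * h - b) * (+ 2 * h - b) + b * b + + 1 ≤ + 2 * + (2 ^ m)
        small′ = subst₂ (λ u P → u * u + b * b + + 1 ≤ P) a≡ (+2^suc m) small
        horner : gi a b ≡ digit d0 ⊕ ω ⊗ gi h (b - h)
        horner = horner-from (+ 0) (+ 0) h (b - h) (trans a≡ (solve (b ∷ h ∷ []))) (solve (b ∷ h ∷ []))
      by-parity (odd h a+b≡2h+1) = subst (Expansion (suc m)) (sym horner)
          (d1 ∷ᵉ small-norm⇒expansion m h (b - h) (odd-norm-halves h b _ 1≤a′ small′))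
        where
        a≡ : a ≡ + 1 + + 2 * h - b
        a≡ = x+y≡s⇒x≡s-y a+b≡2h+1
        small′ : (+ 1 + + 2 * h - b) * (+ 1 + + 2 * h - b) + b * b + + 1 ≤ + 2 * + (2 ^ m)
        small′ = subst₂ (λ u P → u * u + b * b + + 1 ≤ P) a≡ (+2^suc m) small
        1≤a′ : + 1 ≤ + 1 + + 2 * h - b
        1≤a′ = subst (+ 1 ≤_) a≡ 1≤a
        horner : gi a b ≡ digit d1 ⊕ ω ⊗ gi h (b - h)
        horner = horner-from (+ 1) (+ 0) h (b - h) (trans a≡ (solve (b ∷ h ∷ []))) (solve (b ∷ h ∷ []))

normBound : ℕ → ℕ
normBound zero    = 0
normBound (suc m) = suc (normBound m ℕ.+ normBound m ℕ.+ (diag m ℕ.+ diag m))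

horner-norm-bound : ∀ x y p q N T → x * x + y * y ≤ + 1 → x * (p - q) + y * (p + q) ≤ T → p * p + q * q ≤ N →
  (x + (p - q)) * (x + (p - q)) + (y + (p + q)) * (y + (p + q)) ≤ + 1 + (N + N + (T + T))
horner-norm-bound x y p q N T x²+y²≤1 cross≤T p²+q²≤N =
  ≤-offset (x²+y²≤1 ⊞ cross≤T ⊞ cross≤T ⊞ p²+q²≤N ⊞ p²+q²≤N) (solve (x ∷ y ∷ p ∷ q ∷ N ∷ T ∷ []))

digit-norm≤1 : ∀ d → re (digit d) * re (digit d) + im (digit d) * im (digit d) ≤ + 1
digit-norm≤1 d0  = ≤-eval
digit-norm≤1 d1  = ≤-eval
digit-norm≤1 d-1 = ≤-eval
digit-norm≤1 di  = ≤-eval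
digit-norm≤1 d-i = ≤-eval

horner-norm≤ : ∀ {M T N} d p q → Octagon M T p q → p * p + q * q ≤ N →
  norm (digit d ⊕ ω ⊗ gi p q) ≤ + 1 + (N + N + (T + T))
horner-norm≤ {M} {T} {N} d p q O p²+q²≤N =
  subst (_≤ _) (sym (cong norm (horner-step (re (digit d)) (im (digit d)) p q)))
    (horner-norm-bound (re (digit d)) (im (digit d)) p q N T (digit-norm≤1 d) (cross≤T d) p²+q²≤N)
  where
  module O = Octagon O
  cross≤T : ∀ d → re (digit d) * (p - q) + im (digit d) * (p + q) ≤ T
  cross≤T d0  = ≤-offset (halve-≤ (+ 0) T (≤-offset (O.a+b≤ ⊞ O.-a-b≤ ⊞ 0≤ 1) (solve (p ∷ q ∷ T ∷ []))))
      (solve (p ∷ q ∷ T ∷ []))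
  cross≤T d1  = ≤-offset O.a-b≤ (solve (p ∷ q ∷ T ∷ []))
  cross≤T d-1 = ≤-offset O.-a+b≤ (solve (p ∷ q ∷ T ∷ []))
  cross≤T di  = ≤-offset O.a+b≤ (solve (p ∷ q ∷ T ∷ []))
  cross≤T d-i = ≤-offset O.-a-b≤ (solve (p ∷ q ∷ T ∷ []))

expansion-norm≤ : ∀ {m z} → Expansion m z → norm z ≤ + normBound m
expansion-norm≤ []ᵉ = ≤-eval
expansion-norm≤ (_∷ᵉ_ {z = gi p q} d s) = horner-norm≤ d p q (expansion-octagon s) (expansion-norm≤ s)

normBound-closed : ∀ m → normBound m ℕ.+ (diag m ℕ.+ diag m) ℕ.+ (side m ℕ.+ side m) ℕ.+ 5 ≡ 5 ℕ.* 2 ^ m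
normBound-closed zero    = refl
normBound-closed (suc m) = begin
  suc (N ℕ.+ N ℕ.+ (D ℕ.+ D)) ℕ.+ (suc (S ℕ.+ S) ℕ.+ suc (S ℕ.+ S)) ℕ.+ (suc D ℕ.+ suc D) ℕ.+ 5
    ≡⟨ regroup N D S ⟩
  (N ℕ.+ (D ℕ.+ D) ℕ.+ (S ℕ.+ S) ℕ.+ 5) ℕ.+ (N ℕ.+ (D ℕ.+ D) ℕ.+ (S ℕ.+ S) ℕ.+ 5)
    ≡⟨ cong₂ ℕ._+_ (normBound-closed m) (normBound-closed m) ⟩
  5 ℕ.* 2 ^ m ℕ.+ 5 ℕ.* 2 ^ m
    ≡⟨ five-twice (2 ^ m) ⟩
  5 ℕ.* 2 ^ suc m ∎
  where
  open ≡-Reasoning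
  N D S : ℕ
  N = normBound m
  D = diag m
  S = side m
  regroup : ∀ N D S → suc (N ℕ.+ N ℕ.+ (D ℕ.+ D)) ℕ.+ (suc (S ℕ.+ S) ℕ.+ suc (S ℕ.+ S)) ℕ.+ (suc D ℕ.+ suc D) ℕ.+ 5
    ≡ (N ℕ.+ (D ℕ.+ D) ℕ.+ (S ℕ.+ S) ℕ.+ 5) ℕ.+ (N ℕ.+ (D ℕ.+ D) ℕ.+ (S ℕ.+ S) ℕ.+ 5)
  regroup = ℕSolver.solve-∀
  five-twice : ∀ x → 5 ℕ.* x ℕ.+ 5 ℕ.* x ≡ 5 ℕ.* (2 ℕ.* x)
  five-twice = ℕSolver.solve-∀

normBound<5·2^ : ∀ m → + normBound m + + 1 ≤ + 5 * + (2 ^ m)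
normBound<5·2^ m = subst₂ _≤_ (ℤP.pos-+ (normBound m) 1) (trans (cong +_ (normBound-closed m)) (ℤP.pos-* 5 (2 ^ m)))
  (+≤+ (ℕP.+-mono-≤ (ℕP.≤-trans (ℕP.m≤m+n _ _) (ℕP.m≤m+n _ _)) (ℕ.s≤s ℕ.z≤n)))

digit-sum-even⇒d0 : ∀ d k → re (digit d) + im (digit d) ≡ + 2 * k → d ≡ d0
digit-sum-even⇒d0 d0  k e = refl
digit-sum-even⇒d0 d1  k e = ⊥-elim (even≢odd k (+ 0) (sym e))
digit-sum-even⇒d0 d-1 k e = ⊥-elim (even≢odd k (- + 1) (sym e))
digit-sum-even⇒d0 di  k e = ⊥-elim (even≢odd k (+ 0) (sym e))
digit-sum-even⇒d0 d-i k e = ⊥-elim (even≢odd k (- + 1) (sym e))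

ω-cancel : ∀ t u → ω ⊗ t ≡ ω ⊗ u → t ≡ u
ω-cancel (gi t₁ t₂) (gi u₁ u₂) ωt≡ωu = cong₂ gi
  (ℤP.*-cancelˡ-≡ (+ 2) t₁ u₁ (begin
    + 2 * t₁                    ≡⟨ solve (t₁ ∷ t₂ ∷ []) ⟩
    (t₁ - t₂) + (t₁ + t₂)       ≡⟨ cong₂ _+_ (cong re e) (cong im e) ⟩
    (u₁ - u₂) + (u₁ + u₂)       ≡⟨ solve (u₁ ∷ u₂ ∷ []) ⟩
    + 2 * u₁                    ∎))
  (ℤP.*-cancelˡ-≡ (+ 2) t₂ u₂ (begin
    + 2 * t₂                    ≡⟨ solve (t₁ ∷ t₂ ∷ []) ⟩
    (t₁ + t₂) - (t₁ - t₂)       ≡⟨ cong₂ _-_ (cong im e) (cong re e) ⟩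
    (u₁ + u₂) - (u₁ - u₂)       ≡⟨ solve (u₁ ∷ u₂ ∷ []) ⟩
    + 2 * u₂                    ∎))
  where
  open ≡-Reasoning
  e : gi (t₁ - t₂) (t₁ + t₂) ≡ gi (u₁ - u₂) (u₁ + u₂)
  e = trans (sym (ω-mul t₁ t₂)) (trans ωt≡ωu (ω-mul u₁ u₂))

horner-parity : ∀ x y t₁ t₂ u₁ u₂ → x + (t₁ - t₂) ≡ u₁ - u₂ → y + (t₁ + t₂) ≡ u₁ + u₂ →
  x + y ≡ + 2 * (u₁ - t₁)
horner-parity x y t₁ t₂ u₁ u₂ re≡ im≡ = begin
  x + y                                          ≡⟨ solve (x ∷ y ∷ t₁ ∷ t₂ ∷ []) ⟩
  (x + (t₁ - t₂)) + (y + (t₁ + t₂)) - + 2 * t₁   ≡⟨ cong (_- + 2 * t₁) (cong₂ _+_ re≡ im≡) ⟩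
  (u₁ - u₂) + (u₁ + u₂) - + 2 * t₁               ≡⟨ solve (u₁ ∷ u₂ ∷ t₁ ∷ []) ⟩
  + 2 * (u₁ - t₁)                                ∎
  where open ≡-Reasoning

-- Multiples of 1+i have even coordinate sum, nonzero digits odd.
ω-divides-horner : ∀ d t u → digit d ⊕ ω ⊗ t ≡ ω ⊗ u → d ≡ d0 × t ≡ u
ω-divides-horner d (gi t₁ t₂) (gi u₁ u₂) e = d≡d0 , ω-cancel (gi t₁ t₂) (gi u₁ u₂) ωt≡ωu
  where
  x y : ℤ
  x = re (digit d)
  y = im (digit d)
  e′ : gi (x + (t₁ - t₂)) (y + (t₁ + t₂)) ≡ gi (u₁ - u₂) (u₁ + u₂)
  e′ = trans (sym (horner-step x y t₁ t₂)) (trans e (ω-mul u₁ u₂))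
  d≡d0 : d ≡ d0
  d≡d0 = digit-sum-even⇒d0 d (u₁ - t₁) (horner-parity x y t₁ t₂ u₁ u₂ (cong re e′) (cong im e′))
  ωt≡ωu : ω ⊗ gi t₁ t₂ ≡ ω ⊗ gi u₁ u₂
  ωt≡ωu = trans (sym (⊕-identityˡ (ω ⊗ gi t₁ t₂))) (subst (λ d → digit d ⊕ ω ⊗ gi t₁ t₂ ≡ ω ⊗ gi u₁ u₂) d≡d0 e)

Expansion-ω⁻¹ : ∀ {n w} → Expansion (suc n) (ω ⊗ w) → Expansion n w
Expansion-ω⁻¹ {w = w} s =
  let d , z , z∈ , ωw≡ = uncons s in subst (Expansion _) (proj₂ (ω-divides-horner d z w (sym ωw≡))) z∈

even⇒ω-multiple : ∀ {a b h} → a + b ≡ + 2 * h → gi a b ≡ ω ⊗ gi h (b - h)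
even⇒ω-multiple {a} {b} {h} a+b≡2h = begin
  gi a b                          ≡⟨ cong (λ u → gi u b) (x+y≡s⇒x≡s-y a+b≡2h) ⟩
  gi (+ 2 * h - b) b              ≡⟨ cong₂ gi (solve (b ∷ h ∷ [])) (solve (b ∷ h ∷ [])) ⟩
  gi (h - (b - h)) (h + (b - h))  ≡⟨ ω-mul h (b - h) ⟨
  ω ⊗ gi h (b - h)                ∎
  where open ≡-Reasoning

odd⇒1+ω-multiple : ∀ {a b h} → a + b ≡ + 1 + + 2 * h → gi a b ≡ 1G ⊕ ω ⊗ gi h (b - h)
odd⇒1+ω-multiple {a} {b} {h} a+b≡2h+1 =
  horner-from (+ 1) (+ 0) h (b - h) (trans (x+y≡s⇒x≡s-y a+b≡2h+1) (solve (b ∷ h ∷ []))) (solve (b ∷ h ∷ []))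

-- Residue systems and Euclidean functions

CoversResidues : ℕ → GI → Set
CoversResidues m z = ∀ y → Σ GI λ s → Σ GI λ q → Expansion m s × y ≡ s ⊕ q ⊗ z

pronic : ∀ x → (x ≡ + 0 ⊎ x ≡ - + 1) ⊎ + 2 ≤ x * (x + + 1)
pronic (+ zero)     = inj₁ (inj₁ refl)
pronic (+ suc n)    = inj₂ (2≤ (+ n) (0≤ n))
  where
  2≤ : ∀ k → + 0 ≤ k → + 2 ≤ (+ 1 + k) * (+ 1 + k + + 1)
  2≤ k 0≤k = ≤-offset (0≤k ⊞ 0≤k ⊞ 0≤k ⊞ 0≤sq k) (solve (k ∷ []))
pronic -[1+ zero ]  = inj₁ (inj₂ refl)
pronic -[1+ suc n ] = inj₂ (2≤ (+ n) (0≤ n))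
  where
  2≤ : ∀ k → + 0 ≤ k → + 2 ≤ (- (+ 2 + k)) * (- (+ 2 + k) + + 1)
  2≤ k 0≤k = ≤-offset (0≤k ⊞ 0≤k ⊞ 0≤k ⊞ 0≤sq k) (solve (k ∷ []))

0≤pronic : ∀ x → + 0 ≤ x * (x + + 1)
0≤pronic x with pronic x
... | inj₁ (inj₁ refl) = ≤-eval
... | inj₁ (inj₂ refl) = ≤-eval
... | inj₂ 2≤x[x+1]   = ℤP.≤-trans (0≤ 2) 2≤x[x+1]

norm-1+ω : ∀ q₁ q₂ → norm (1G ⊕ ω ⊗ gi q₁ q₂) ≡ + 1 + + 2 * (q₁ * (q₁ + + 1) + (- q₂) * (- q₂ + + 1))
norm-1+ω q₁ q₂ = begin
  norm (1G ⊕ ω ⊗ gi q₁ q₂)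
    ≡⟨ cong norm (horner-step (+ 1) (+ 0) q₁ q₂) ⟩
  (+ 1 + (q₁ - q₂)) * (+ 1 + (q₁ - q₂)) + (+ 0 + (q₁ + q₂)) * (+ 0 + (q₁ + q₂))
    ≡⟨ solve (q₁ ∷ q₂ ∷ []) ⟩
  + 1 + + 2 * (q₁ * (q₁ + + 1) + (- q₂) * (- q₂ + + 1)) ∎
  where open ≡-Reasoning

unit-inverse : ∀ q₁ q₂ → q₁ ≡ + 0 ⊎ q₁ ≡ - + 1 → q₂ ≡ + 0 ⊎ q₂ ≡ + 1 →
  Σ Digit λ ū → digit ū ⊗ (1G ⊕ ω ⊗ gi q₁ q₂) ≡ 1G
unit-inverse _ _ (inj₁ refl) (inj₁ refl) = d1 , refl
unit-inverse _ _ (inj₁ refl) (inj₂ refl) = d-i , refl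
unit-inverse _ _ (inj₂ refl) (inj₁ refl) = di , refl
unit-inverse _ _ (inj₂ refl) (inj₂ refl) = d-1 , refl

-- Norm of 1 + (1+i)q is 1 + 2(q₁(q₁+1) + q₂(q₂−1)); it is below 5 only for the four units.
5≤norm⊎invertible : ∀ q → + 5 ≤ norm (1G ⊕ ω ⊗ q) ⊎ Σ Digit λ ū → digit ū ⊗ (1G ⊕ ω ⊗ q) ≡ 1G
5≤norm⊎invertible (gi q₁ q₂) = by-cases (pronic q₁) (pronic (- q₂))
  where
  5≤norm : ∀ {P Q} → + 2 ≤ P → + 0 ≤ Q → + 5 ≤ + 1 + + 2 * (P + Q)
  5≤norm {P} {Q} 2≤P 0≤Q = ≤-offset (2≤P ⊞ 2≤P ⊞ 0≤Q ⊞ 0≤Q) (solve (P ∷ Q ∷ []))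

  by-cases : (q₁ ≡ + 0 ⊎ q₁ ≡ - + 1) ⊎ + 2 ≤ q₁ * (q₁ + + 1) →
             (- q₂ ≡ + 0 ⊎ - q₂ ≡ - + 1) ⊎ + 2 ≤ (- q₂) * (- q₂ + + 1) →
             + 5 ≤ norm (1G ⊕ ω ⊗ gi q₁ q₂) ⊎ Σ Digit λ ū → digit ū ⊗ (1G ⊕ ω ⊗ gi q₁ q₂) ≡ 1G
  by-cases (inj₂ 2≤) _ = inj₁ (subst (+ 5 ≤_) (sym (norm-1+ω q₁ q₂)) (5≤norm 2≤ (0≤pronic (- q₂))))
  by-cases (inj₁ _) (inj₂ 2≤) =
    inj₁ (subst (+ 5 ≤_) (sym (trans (norm-1+ω q₁ q₂) (cong (λ u → + 1 + + 2 * u) (ℤP.+-comm (q₁ * (q₁ + + 1)) (- q₂ * (- q₂ + + 1))))))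
                (5≤norm 2≤ (0≤pronic q₁)))
  by-cases (inj₁ q₁∈) (inj₁ -q₂∈) =
    inj₂ (unit-inverse q₁ q₂ q₁∈ (⊎-map ℤP.neg-injective ℤP.neg-injective -q₂∈))

neg≡⊕⇒⊕≡neg : ∀ {w s r} → neg w ≡ s ⊕ r → w ⊕ r ≡ neg s
neg≡⊕⇒⊕≡neg {gi w₁ w₂} {gi s₁ s₂} {gi r₁ r₂} e = cong₂ gi (rearrange (cong re e)) (rearrange (cong im e))
  where
  rearrange : ∀ {w s r} → - w ≡ s + r → w + r ≡ - s
  rearrange {w} {s} {r} -w≡s+r = begin
    w + r            ≡⟨ solve (w ∷ r ∷ []) ⟩
    r - (- w)        ≡⟨ cong (λ u → r - u) -w≡s+r ⟩
    r - (s + r)      ≡⟨ solve (s ∷ r ∷ []) ⟩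
    - s              ∎
    where open ≡-Reasoning

unit-factor-equation : ∀ w s q → neg w ≡ s ⊕ q ⊗ (1G ⊕ ω ⊗ w) →
  (1G ⊕ ω ⊗ q) ⊗ (1G ⊕ ω ⊗ w) ≡ 1G ⊕ ω ⊗ neg s
unit-factor-equation w s q -w≡ = begin
  (1G ⊕ ω ⊗ q) ⊗ z               ≡⟨ ⊗-distribʳ-⊕ z 1G (ω ⊗ q) ⟩
  1G ⊗ z ⊕ (ω ⊗ q) ⊗ z           ≡⟨ cong₂ _⊕_ (⊗-identityˡ z) (⊗-assoc ω q z) ⟩
  (1G ⊕ ω ⊗ w) ⊕ ω ⊗ (q ⊗ z)     ≡⟨ ⊕-assoc 1G (ω ⊗ w) (ω ⊗ (q ⊗ z)) ⟩
  1G ⊕ (ω ⊗ w ⊕ ω ⊗ (q ⊗ z))     ≡⟨ cong (1G ⊕_) (⊗-distribˡ-⊕ ω w (q ⊗ z)) ⟨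
  1G ⊕ ω ⊗ (w ⊕ q ⊗ z)           ≡⟨ cong (λ u → 1G ⊕ ω ⊗ u) (neg≡⊕⇒⊕≡neg {w} {s} {q ⊗ z} -w≡) ⟩
  1G ⊕ ω ⊗ neg s                 ∎
  where
  open ≡-Reasoning
  z : GI
  z = 1G ⊕ ω ⊗ w

covers⇒expansion : ∀ m z → z ≢ 0G → CoversResidues m z → Expansion (suc m) z
covers-ω⇒expansion : ∀ m w → w ≢ 0G → CoversResidues m (ω ⊗ w) → Expansion (suc m) (ω ⊗ w)
covers-odd⇒expansion : ∀ m w → CoversResidues m (1G ⊕ ω ⊗ w) → Expansion (suc m) (1G ⊕ ω ⊗ w)

covers⇒expansion m (gi a b) z≢0 covers = by-parity (parity (a + b))
  where
  by-parity : Parity (a + b) → Expansion (suc m) (gi a b)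
  by-parity (even h a+b≡2h) =
    subst (Expansion (suc m)) (sym z≡) (covers-ω⇒expansion m (gi h (b - h)) w≢0 (subst (CoversResidues m) z≡ covers))
    where
    z≡ : gi a b ≡ ω ⊗ gi h (b - h)
    z≡ = even⇒ω-multiple a+b≡2h
    w≢0 : gi h (b - h) ≢ 0G
    w≢0 w≡0 = z≢0 (trans z≡ (cong (ω ⊗_) w≡0))
  by-parity (odd h a+b≡2h+1) =
    subst (Expansion (suc m)) (sym z≡) (covers-odd⇒expansion m (gi h (b - h)) (subst (CoversResidues m) z≡ covers))
    where
    z≡ : gi a b ≡ 1G ⊕ ω ⊗ gi h (b - h)
    z≡ = odd⇒1+ω-multiple a+b≡2h+1

covers-ω⇒expansion zero w _ covers = 1≢ω-multiple (covers 1G)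
  where
  1≢ω-multiple : (Σ GI λ s → Σ GI λ q → Expansion 0 s × 1G ≡ s ⊕ q ⊗ (ω ⊗ w)) → Expansion 1 (ω ⊗ w)
  1≢ω-multiple (s , q , s∈ , 1≡) = ⊥-elim (d1≢d0 (proj₁ (ω-divides-horner d1 0G (q ⊗ w) 1≡ω[qw])))
    where
    d1≢d0 : d1 ≢ d0
    d1≢d0 ()
    1≡ω[qw] : 1G ≡ ω ⊗ (q ⊗ w)
    1≡ω[qw] = begin
      1G                 ≡⟨ 1≡ ⟩
      s ⊕ q ⊗ (ω ⊗ w)    ≡⟨ cong (_⊕ q ⊗ (ω ⊗ w)) (Expansion₀⇒≡0 s∈) ⟩
      0G ⊕ q ⊗ (ω ⊗ w)   ≡⟨ ⊕-identityˡ (q ⊗ (ω ⊗ w)) ⟩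
      q ⊗ (ω ⊗ w)        ≡⟨ ⊗-left-comm q ω w ⟩
      ω ⊗ (q ⊗ w)        ∎
      where open ≡-Reasoning
covers-ω⇒expansion (suc m) w w≢0 covers =
  subst (Expansion _) (⊕-identityˡ (ω ⊗ w)) (d0 ∷ᵉ covers⇒expansion m w w≢0 covers-w)
  where
  covers-w : CoversResidues m w
  covers-w y =
    let s , q , s∈ , ωy≡s+q[ωw] = covers (ω ⊗ y)
        d , s′ , s′∈ , s≡ = uncons s∈
        ωy≡ : ω ⊗ y ≡ digit d ⊕ ω ⊗ (s′ ⊕ q ⊗ w)
        ωy≡ = trans ωy≡s+q[ωw] (trans (cong (_⊕ q ⊗ (ω ⊗ w)) s≡) (horner-absorb (digit d) s′ q w))
    in s′ , q , s′∈ , sym (proj₂ (ω-divides-horner d (s′ ⊕ q ⊗ w) y (sym ωy≡)))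

covers-odd⇒expansion m w covers = by-size (norm z + + 1 ℤP.≤? + (2 ^ suc m))
  where
  z : GI
  z = 1G ⊕ ω ⊗ w

  by-size : Dec (norm z + + 1 ≤ + (2 ^ suc m)) → Expansion (suc m) z
  by-size (yes small) = small-norm⇒expansion (suc m) (re z) (im z) small
  by-size (no large)  = let s , q , s∈ , -w≡ = covers (neg w) in by-unit s q s∈ -w≡ (5≤norm⊎invertible q)
    where
    2^≤norm : + (2 ^ suc m) ≤ norm z
    2^≤norm = suc≤suc⁻¹ (≰⇒suc≤ large)

    by-unit : ∀ s q → Expansion m s → neg w ≡ s ⊕ q ⊗ z →
      + 5 ≤ norm (1G ⊕ ω ⊗ q) ⊎ Σ Digit (λ ū → digit ū ⊗ (1G ⊕ ω ⊗ q) ≡ 1G) → Expansion (suc m) z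
    by-unit s q s∈ -w≡ factor = by-factor factor
      where
      t : GI
      t = 1G ⊕ ω ⊗ q
      tz∈ : Expansion (suc m) (t ⊗ z)
      tz∈ = subst (Expansion (suc m)) (sym (unit-factor-equation w s q -w≡)) (d1 ∷ᵉ Expansion-neg s∈)

      by-factor : + 5 ≤ norm t ⊎ Σ Digit (λ ū → digit ū ⊗ t ≡ 1G) → Expansion (suc m) z
      by-factor (inj₁ 5≤norm-t) = ⊥-elim (small-product⇒factor<5 (0≤norm z) 2^≤norm
        (subst (_≤ _) (norm-⊗ t z) (expansion-norm≤ tz∈)) (normBound<5·2^ (suc m)) 5≤norm-t)
      by-factor (inj₂ (ū , ūt≡1)) = subst (Expansion (suc m)) ū[tz]≡z (Expansion-digit-⊗ ū tz∈)
        where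
        ū[tz]≡z : digit ū ⊗ (t ⊗ z) ≡ z
        ū[tz]≡z = trans (sym (⊗-assoc (digit ū) t z)) (trans (cong (_⊗ z) ūt≡1) (⊗-identityˡ z))

-- Division with remainder represents each residue class modulo z by 0 or by some r with f r < f z < m.
euclidean⇒expansion : ∀ {f} → IsEuclidean f → ∀ m z → z ≢ 0G → f z ℕ.< m → Expansion m z
euclidean⇒expansion euc zero z z≢0 ()
euclidean⇒expansion {f} euc (suc m) z z≢0 fz<1+m = covers⇒expansion m z z≢0 covers
  where
  remainder∈ : ∀ r → r ≡ 0G ⊎ f r ℕ.< f z → Expansion m r
  remainder∈ r r-small with r ≟ᴳ 0G | r-small
  ... | yes r≡0 | _           = subst (Expansion m) (sym r≡0) (expansion-0 m)
  ... | no r≢0  | inj₁ r≡0    = ⊥-elim (r≢0 r≡0)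
  ... | no r≢0  | inj₂ fr<fz  = euclidean⇒expansion euc m r r≢0 (ℕP.<-≤-trans fr<fz (ℕP.≤-pred fz<1+m))

  covers : CoversResidues m z
  covers y with y ≟ᴳ 0G
  ... | yes y≡0 = y , 0G , remainder∈ y (inj₁ y≡0) , sym (trans (cong (y ⊕_) (⊗-zeroˡ z)) (⊕-identityʳ y))
  ... | no y≢0  = let q , r , y≡ , r-small = euc y z y≢0 z≢0
                  in r , q , remainder∈ r r-small , trans y≡ (⊕-comm (q ⊗ z) r)

-- Subtracting 2^j(1+i)

double : ℕ → ℕ
double zero    = 0
double (suc j) = suc (suc (double j))

double≡2* : ∀ j → double j ≡ 2 ℕ.* j
double≡2* zero    = refl
double≡2* (suc j) = trans (cong (λ n → suc (suc n)) (double≡2* j)) (step j)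
  where
  step : ∀ j → suc (suc (2 ℕ.* j)) ≡ 2 ℕ.* suc j
  step = ℕSolver.solve-∀

iterate-doubling : ∀ (f : ℕ → ℕ) c → (∀ n → f (suc (suc n)) ℕ.+ c ≡ 2 ℕ.* (f n ℕ.+ c)) →
  ∀ j → f (double j) ℕ.+ c ≡ 2 ^ j ℕ.* (f 0 ℕ.+ c)
iterate-doubling f c step zero    = sym (ℕP.*-identityˡ (f 0 ℕ.+ c))
iterate-doubling f c step (suc j) = begin
  f (double (suc j)) ℕ.+ c        ≡⟨ step (double j) ⟩
  2 ℕ.* (f (double j) ℕ.+ c)      ≡⟨ cong (2 ℕ.*_) (iterate-doubling f c step j) ⟩
  2 ℕ.* (2 ^ j ℕ.* (f 0 ℕ.+ c))   ≡⟨ ℕP.*-assoc 2 (2 ^ j) (f 0 ℕ.+ c) ⟨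
  2 ^ suc j ℕ.* (f 0 ℕ.+ c)       ∎
  where open ≡-Reasoning

side-step : ∀ n → side (suc (suc n)) ℕ.+ 2 ≡ 2 ℕ.* (side n ℕ.+ 2)
side-step n = step (side n)
  where
  step : ∀ x → suc (suc (x ℕ.+ x)) ℕ.+ 2 ≡ 2 ℕ.* (x ℕ.+ 2)
  step = ℕSolver.solve-∀

diag-step : ∀ n → diag (suc (suc n)) ℕ.+ 3 ≡ 2 ℕ.* (diag n ℕ.+ 3)
diag-step n = step (diag n)
  where
  step : ∀ x → suc (suc x ℕ.+ suc x) ℕ.+ 3 ≡ 2 ℕ.* (x ℕ.+ 3)
  step = ℕSolver.solve-∀

ℕ-closed⇒ℤ : ∀ m c {k} j → m ℕ.+ c ≡ 2 ^ j ℕ.* k → + m + + c ≡ + k * + (2 ^ j)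
ℕ-closed⇒ℤ m c {k} j e =
  trans (sym (ℤP.pos-+ m c)) (trans (cong +_ (trans e (ℕP.*-comm (2 ^ j) k))) (ℤP.pos-* k (2 ^ j)))

side-even : ∀ j → + side (double j) + + 2 ≡ + 2 * + (2 ^ j)
side-even j = ℕ-closed⇒ℤ _ 2 j (iterate-doubling side 2 side-step j)

diag-even : ∀ j → + diag (double j) + + 3 ≡ + 3 * + (2 ^ j)
diag-even j = ℕ-closed⇒ℤ _ 3 j (iterate-doubling diag 3 diag-step j)

side-odd : ∀ j → + side (suc (double j)) + + 2 ≡ + 3 * + (2 ^ j)
side-odd j = ℕ-closed⇒ℤ (side (suc (double j))) 2 j (iterate-doubling (λ n → side (suc n)) 2 (λ n → side-step (suc n)) j)

diag-odd : ∀ j → + diag (suc (double j)) + + 3 ≡ + 4 * + (2 ^ j)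
diag-odd j = ℕ-closed⇒ℤ (diag (suc (double j))) 3 j (iterate-doubling (λ n → diag (suc n)) 3 (λ n → diag-step (suc n)) j)

octagon-shift-sector : ∀ {a b P M₁ T₁ M₀ T₀} → + 2 ≤ P → M₁ + + 2 ≡ + 3 * P → T₁ + + 3 ≡ + 4 * P →
  M₀ + + 2 ≡ + 2 * P → T₀ + + 3 ≡ + 3 * P → b ≤ a → - b ≤ a → Octagon M₁ T₁ a b → Octagon M₀ T₀ (a - P) b
octagon-shift-sector {a} {b} {P} {M₁} {T₁} {M₀} {T₀} 2≤P M₁≡ T₁≡ M₀≡ T₀≡ b≤a -b≤a O = record
  { a≤    = ≤-offset (O.a≤ ⊞ ≤-reflexive M₁≡ ⊞ ≤-reflexive (sym M₀≡)) (solve (a ∷ b ∷ P ∷ M₁ ∷ M₀ ∷ []))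
  ; -a≤   = ≤-offset (0≤a ⊞ 2≤P ⊞ ≤-reflexive (sym M₀≡)) (solve (a ∷ b ∷ P ∷ M₀ ∷ []))
  ; b≤    = halve-≤ b M₀ (≤-offset (b≤a ⊞ O.a+b≤ ⊞ ≤-reflexive T₁≡ ⊞ ≤-reflexive (sym M₀≡) ⊞ ≤-reflexive (sym M₀≡))
        (solve (a ∷ b ∷ P ∷ T₁ ∷ M₀ ∷ [])))
  ; -b≤   = halve-≤ (- b) M₀ (≤-offset (-b≤a ⊞ O.a-b≤ ⊞ ≤-reflexive T₁≡ ⊞ ≤-reflexive (sym M₀≡) ⊞ ≤-reflexive (sym M₀≡))
        (solve (a ∷ b ∷ P ∷ T₁ ∷ M₀ ∷ [])))
  ; a+b≤  = ≤-offset (O.a+b≤ ⊞ ≤-reflexive T₁≡ ⊞ ≤-reflexive (sym T₀≡)) (solve (a ∷ b ∷ P ∷ T₁ ∷ T₀ ∷ []))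
  ; a-b≤  = ≤-offset (O.a-b≤ ⊞ ≤-reflexive T₁≡ ⊞ ≤-reflexive (sym T₀≡)) (solve (a ∷ b ∷ P ∷ T₁ ∷ T₀ ∷ []))
  ; -a+b≤ = ≤-offset (b≤a ⊞ 2≤P ⊞ 2≤P ⊞ ≤-reflexive (sym T₀≡) ⊞ 0≤ 1) (solve (a ∷ b ∷ P ∷ T₀ ∷ []))
  ; -a-b≤ = ≤-offset (-b≤a ⊞ 2≤P ⊞ 2≤P ⊞ ≤-reflexive (sym T₀≡) ⊞ 0≤ 1) (solve (a ∷ b ∷ P ∷ T₀ ∷ []))
  }
  where
  module O = Octagon O
  0≤a : + 0 ≤ a
  0≤a = sector⇒0≤ b≤a -b≤a

octagon-shift-quadrant : ∀ {a b h P M₂ T₂ M₁ T₁} → + 1 ≤ P → M₂ + + 2 ≡ + 4 * P → T₂ + + 3 ≡ + 6 * P →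
  M₁ + + 2 ≡ + 3 * P → T₁ + + 3 ≡ + 4 * P → + 0 ≤ a → + 0 ≤ b → a + b ≡ + 1 + + 2 * h →
  Octagon M₂ T₂ a b → Octagon M₁ T₁ (a - P) (b - P)
octagon-shift-quadrant {a} {b} {h} {P} {M₂} {T₂} {M₁} {T₁} 1≤P M₂≡ T₂≡ M₁≡ T₁≡ 0≤a 0≤b a+b≡ O = record
  { a≤    = ≤-offset (O.a≤ ⊞ ≤-reflexive M₂≡ ⊞ ≤-reflexive (sym M₁≡)) (solve (a ∷ b ∷ P ∷ M₂ ∷ M₁ ∷ []))
  ; -a≤   = ≤-offset (0≤a ⊞ 1≤P ⊞ 1≤P ⊞ ≤-reflexive (sym M₁≡)) (solve (a ∷ b ∷ P ∷ M₂ ∷ M₁ ∷ []))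
  ; b≤    = ≤-offset (O.b≤ ⊞ ≤-reflexive M₂≡ ⊞ ≤-reflexive (sym M₁≡)) (solve (a ∷ b ∷ P ∷ M₂ ∷ M₁ ∷ []))
  ; -b≤   = ≤-offset (0≤b ⊞ 1≤P ⊞ 1≤P ⊞ ≤-reflexive (sym M₁≡)) (solve (a ∷ b ∷ P ∷ M₂ ∷ M₁ ∷ []))
  ; a+b≤  = ≤-offset (O.a+b≤ ⊞ ≤-reflexive T₂≡ ⊞ ≤-reflexive (sym T₁≡)) (solve (a ∷ b ∷ P ∷ T₂ ∷ T₁ ∷ []))
  ; a-b≤  = ≤-offset (h-b≤ ⊞ h-b≤ ⊞ ≤-reflexive a+b≡ ⊞ ≤-reflexive (sym T₁≡))
        (solve (a ∷ b ∷ h ∷ P ∷ T₂ ∷ T₁ ∷ []))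
  ; -a+b≤ = ≤-offset (h-a≤ ⊞ h-a≤ ⊞ ≤-reflexive a+b≡ ⊞ ≤-reflexive (sym T₁≡))
        (solve (a ∷ b ∷ h ∷ P ∷ T₂ ∷ T₁ ∷ []))
  ; -a-b≤ = ≤-offset (≤-reflexive (sym a+b≡) ⊞ 0≤h ⊞ 0≤h ⊞ 1≤P ⊞ 1≤P ⊞ ≤-reflexive (sym T₁≡))
        (solve (a ∷ b ∷ h ∷ P ∷ T₂ ∷ T₁ ∷ []))
  }
  where
  module O = Octagon O
  h-b≤ : h - b ≤ + 2 * P - + 2
  h-b≤ = halve-≤ (h - b) (+ 2 * P - + 2) (≤-offset (≤-reflexive (sym a+b≡) ⊞ 0≤b ⊞ O.a≤ ⊞ ≤-reflexive M₂≡)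
      (solve (a ∷ b ∷ h ∷ P ∷ M₂ ∷ [])))
  h-a≤ : h - a ≤ + 2 * P - + 2
  h-a≤ = halve-≤ (h - a) (+ 2 * P - + 2) (≤-offset (≤-reflexive (sym a+b≡) ⊞ 0≤a ⊞ O.b≤ ⊞ ≤-reflexive M₂≡)
      (solve (a ∷ b ∷ h ∷ P ∷ M₂ ∷ [])))
  0≤h : + 0 ≤ h
  0≤h = ≤-offset (halve-≤ (- h) (+ 0) (≤-offset (≤-reflexive a+b≡ ⊞ 0≤a ⊞ 0≤b) (solve (a ∷ b ∷ h ∷ []))))
      (solve (h ∷ []))

expansion-shift-sector : ∀ j a b → Expansion (suc (double j)) (gi a b) → gi a b ≢ 0G → b ≤ a → - b ≤ a →
  Expansion (double j) (gi (a - + (2 ^ j)) b)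
expansion-shift-quadrant : ∀ j a b → Expansion (suc (suc (double j))) (gi a b) → gi a b ≢ 0G → + 0 ≤ a → + 0 ≤ b →
  Expansion (suc (double j)) (gi (a - + (2 ^ j)) (b - + (2 ^ j)))

expansion-shift-sector zero a b z∈ z≢0 b≤a -b≤a =
  let d , z , z∈₀ , z≡ = uncons z∈ in by-digit d (trans z≡ (cong (λ u → digit d ⊕ ω ⊗ u) (Expansion₀⇒≡0 z∈₀)))
  where
  by-digit : ∀ d → gi a b ≡ digit d ⊕ ω ⊗ 0G → Expansion 0 (gi (a - + 1) b)
  by-digit d0  z≡ = ⊥-elim (z≢0 z≡)
  by-digit d1  z≡ = subst (Expansion 0) (cong₂ gi (cong (_- + 1) (sym (cong re z≡))) (sym (cong im z≡))) []ᵉ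
  by-digit d-1 z≡ = ⊥-elim (1≰0 (≤-offset (subst₂ _≤_ (cong im z≡) (cong re z≡) b≤a) refl))
  by-digit di  z≡ = ⊥-elim (1≰0 (subst₂ _≤_ (cong im z≡) (cong re z≡) b≤a))
  by-digit d-i z≡ = ⊥-elim (1≰0 (subst₂ (λ u v → - u ≤ v) (cong im z≡) (cong re z≡) -b≤a))
expansion-shift-sector (suc j) a b z∈ z≢0 b≤a -b≤a = by-parity (parity (a + b))
  where
  P : ℤ
  P = + (2 ^ j)
  by-parity : Parity (a + b) → Expansion (double (suc j)) (gi (a - + (2 ^ suc j)) b)
  by-parity (even h a+b≡2h) = subst (Expansion _) (sym z′≡) (d0 ∷ᵉ iw′∈)
    where
    z≡ : gi a b ≡ ω ⊗ gi h (b - h)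
    z≡ = even⇒ω-multiple a+b≡2h
    w∈ : Expansion (suc (suc (double j))) (gi h (b - h))
    w∈ = Expansion-ω⁻¹ (subst (Expansion _) z≡ z∈)
    w≢0 : gi h (b - h) ≢ 0G
    w≢0 w≡0 = z≢0 (trans z≡ (cong (ω ⊗_) w≡0))
    0≤h-b : + 0 ≤ - (b - h)
    0≤h-b = halve-≤ (+ 0) (- (b - h)) (≤-offset (b≤a ⊞ ≤-reflexive a+b≡2h ⊞ 0≤ 1) (solve (a ∷ b ∷ h ∷ [])))
    0≤h : + 0 ≤ h
    0≤h = halve-≤ (+ 0) h (≤-offset (-b≤a ⊞ ≤-reflexive a+b≡2h ⊞ 0≤ 1) (solve (a ∷ b ∷ h ∷ [])))
    iw′∈ : Expansion (suc (double j)) (gi (- - (h - P)) (- (- (b - h) - P)))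
    iw′∈ = Expansion-mul-i (Expansion-mul-i (Expansion-mul-i
             (expansion-shift-quadrant j (- (b - h)) h (Expansion-mul-i w∈) (mul-i-≢0 w≢0) 0≤h-b 0≤h)))
    z′≡ : gi (a - + (2 ^ suc j)) b ≡ digit d0 ⊕ ω ⊗ gi (- - (h - P)) (- (- (b - h) - P))
    z′≡ = horner-from (+ 0) (+ 0) (- - (h - P)) (- (- (b - h) - P))
      (trans (cong₂ _-_ (x+y≡s⇒x≡s-y {a} a+b≡2h) (+2^suc j)) (re≡ b h P)) (im≡ b h P)
      where
      re≡ : ∀ b h P → + 2 * h - b - + 2 * P ≡ + 0 + (- - (h - P) - - (- (b - h) - P))
      re≡ b h P = solve (b ∷ h ∷ P ∷ [])
      im≡ : ∀ b h P → b ≡ + 0 + (- - (h - P) + - (- (b - h) - P))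
      im≡ b h P = solve (b ∷ h ∷ P ∷ [])
  by-parity (odd h a+b≡2h+1) =
    odd-octagon⇒expansion (suc (double j)) (a - + (2 ^ suc j)) b (h - P) shifted-odd
      (octagon-shift-sector 2≤2P (side-odd (suc j)) (diag-odd (suc j)) (side-even (suc j)) (diag-even (suc j))
        b≤a -b≤a (expansion-octagon z∈))
    where
    2≤2P : + 2 ≤ + (2 ^ suc j)
    2≤2P = +≤+ (ℕP.*-monoʳ-≤ 2 (ℕP.m^n>0 2 j))
    shifted-odd : a - + (2 ^ suc j) + b ≡ + 1 + + 2 * (h - P)
    shifted-odd = shift-odd a b h _ P a+b≡2h+1 (+2^suc j)
      where
      shift-odd : ∀ a b h Q P → a + b ≡ + 1 + + 2 * h → Q ≡ + 2 * P → a - Q + b ≡ + 1 + + 2 * (h - P)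
      shift-odd a b h Q P a+b≡ Q≡ = begin
        a - Q + b                  ≡⟨ solve (a ∷ b ∷ Q ∷ []) ⟩
        (a + b) - Q                ≡⟨ cong₂ _-_ a+b≡ Q≡ ⟩
        (+ 1 + + 2 * h) - + 2 * P  ≡⟨ solve (h ∷ P ∷ []) ⟩
        + 1 + + 2 * (h - P)        ∎
        where open ≡-Reasoning

expansion-shift-quadrant j a b z∈ z≢0 0≤a 0≤b = by-parity (parity (a + b))
  where
  P : ℤ
  P = + (2 ^ j)
  by-parity : Parity (a + b) → Expansion (suc (double j)) (gi (a - P) (b - P))
  by-parity (even h a+b≡2h) = subst (Expansion _) (sym z′≡) (d0 ∷ᵉ w′∈)
    where
    z≡ : gi a b ≡ ω ⊗ gi h (b - h)
    z≡ = even⇒ω-multiple a+b≡2h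
    w∈ : Expansion (suc (double j)) (gi h (b - h))
    w∈ = Expansion-ω⁻¹ (subst (Expansion _) z≡ z∈)
    w≢0 : gi h (b - h) ≢ 0G
    w≢0 w≡0 = z≢0 (trans z≡ (cong (ω ⊗_) w≡0))
    w′∈ : Expansion (double j) (gi (h - P) (b - h))
    w′∈ = expansion-shift-sector j h (b - h) w∈ w≢0
            (≤-offset (0≤a ⊞ ≤-reflexive a+b≡2h) (solve (a ∷ b ∷ h ∷ [])))
            (≤-offset 0≤b (solve (b ∷ h ∷ [])))
    z′≡ : gi (a - P) (b - P) ≡ digit d0 ⊕ ω ⊗ gi (h - P) (b - h)
    z′≡ = horner-from (+ 0) (+ 0) (h - P) (b - h)
      (trans (cong (_- P) (x+y≡s⇒x≡s-y {a} a+b≡2h)) (re≡ b h P)) (im≡ b h P)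
      where
      re≡ : ∀ b h P → + 2 * h - b - P ≡ + 0 + ((h - P) - (b - h))
      re≡ b h P = solve (b ∷ h ∷ P ∷ [])
      im≡ : ∀ b h P → b - P ≡ + 0 + ((h - P) + (b - h))
      im≡ b h P = solve (b ∷ h ∷ P ∷ [])
  by-parity (odd h a+b≡2h+1) =
    odd-octagon⇒expansion (double j) (a - P) (b - P) (h - P) shifted-odd
      (octagon-shift-quadrant {h = h} (+≤+ (ℕP.m^n>0 2 j)) M₂≡ T₂≡ (side-odd j) (diag-odd j) 0≤a 0≤b a+b≡2h+1
        (expansion-octagon z∈))
    where
    M₂≡ : + side (double (suc j)) + + 2 ≡ + 4 * P
    M₂≡ = trans (side-even (suc j)) (trans (cong (+ 2 *_) (+2^suc j)) (sym (ℤP.*-assoc (+ 2) (+ 2) P)))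
    T₂≡ : + diag (double (suc j)) + + 3 ≡ + 6 * P
    T₂≡ = trans (diag-even (suc j)) (trans (cong (+ 3 *_) (+2^suc j)) (sym (ℤP.*-assoc (+ 3) (+ 2) P)))
    shifted-odd : (a - P) + (b - P) ≡ + 1 + + 2 * (h - P)
    shifted-odd = shift-odd a b h P a+b≡2h+1
      where
      shift-odd : ∀ a b h P → a + b ≡ + 1 + + 2 * h → (a - P) + (b - P) ≡ + 1 + + 2 * (h - P)
      shift-odd a b h P a+b≡ = begin
        (a - P) + (b - P)          ≡⟨ solve (a ∷ b ∷ P ∷ []) ⟩
        (a + b) - + 2 * P          ≡⟨ cong (_- + 2 * P) a+b≡ ⟩
        (+ 1 + + 2 * h) - + 2 * P  ≡⟨ solve (h ∷ P ∷ []) ⟩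
        + 1 + + 2 * (h - P)        ∎
        where open ≡-Reasoning

-- Leading terms

expandFrom-suc : ∀ j us → expandFrom (suc j) us ≡ ω ⊗ expandFrom j us
expandFrom-suc j []       = refl
expandFrom-suc j (u ∷ us) = begin
  digit u ⊗ (ω ⊗ ω ^G j) ⊕ expandFrom (suc (suc j)) us      ≡⟨ cong₂ _⊕_ (⊗-left-comm (digit u) ω (ω ^G j)) (expandFrom-suc (suc j) us) ⟩
  ω ⊗ (digit u ⊗ ω ^G j) ⊕ ω ⊗ expandFrom (suc j) us        ≡⟨ ⊗-distribˡ-⊕ ω (digit u ⊗ ω ^G j) (expandFrom (suc j) us) ⟨
  ω ⊗ (digit u ⊗ ω ^G j ⊕ expandFrom (suc j) us)            ∎
  where open ≡-Reasoning

expansion⇒digits : ∀ {n z} → Expansion n z → Σ (List Digit) λ us → length us ≡ n × expand us ≡ z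
expansion⇒digits []ᵉ = [] , refl , refl
expansion⇒digits (_∷ᵉ_ {z = z} d s) =
  let us , length≡ , expand≡ = expansion⇒digits s
  in d ∷ us , cong suc length≡ ,
     cong₂ _⊕_ (⊗-identityʳ (digit d)) (trans (expandFrom-suc 0 us) (cong (ω ⊗_) expand≡))

expandFrom-snoc : ∀ j us u → expandFrom j (us ++ u ∷ []) ≡ expandFrom j us ⊕ digit u ⊗ ω ^G (j ℕ.+ length us)
expandFrom-snoc j [] u = begin
  digit u ⊗ ω ^G j ⊕ 0G              ≡⟨ ⊕-identityʳ (digit u ⊗ ω ^G j) ⟩
  digit u ⊗ ω ^G j                   ≡⟨ cong (λ n → digit u ⊗ ω ^G n) (ℕP.+-identityʳ j) ⟨
  digit u ⊗ ω ^G (j ℕ.+ 0)           ≡⟨ ⊕-identityˡ (digit u ⊗ ω ^G (j ℕ.+ 0)) ⟨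
  0G ⊕ digit u ⊗ ω ^G (j ℕ.+ 0)      ∎
  where open ≡-Reasoning
expandFrom-snoc j (v ∷ us) u = begin
  digit v ⊗ ω ^G j ⊕ expandFrom (suc j) (us ++ u ∷ [])
    ≡⟨ cong (digit v ⊗ ω ^G j ⊕_) (expandFrom-snoc (suc j) us u) ⟩
  digit v ⊗ ω ^G j ⊕ (expandFrom (suc j) us ⊕ digit u ⊗ ω ^G (suc j ℕ.+ length us))
    ≡⟨ ⊕-assoc (digit v ⊗ ω ^G j) (expandFrom (suc j) us) _ ⟨
  (digit v ⊗ ω ^G j ⊕ expandFrom (suc j) us) ⊕ digit u ⊗ ω ^G (suc j ℕ.+ length us)
    ≡⟨ cong (λ n → (digit v ⊗ ω ^G j ⊕ expandFrom (suc j) us) ⊕ digit u ⊗ ω ^G n) (ℕP.+-suc j (length us)) ⟨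
  (digit v ⊗ ω ^G j ⊕ expandFrom (suc j) us) ⊕ digit u ⊗ ω ^G (j ℕ.+ suc (length us)) ∎
  where open ≡-Reasoning

LeadingExpansion : ℕ → GI → GI → Set
LeadingExpansion n z c = Σ (List Digit) λ us → Σ Digit λ u → (length us ≡ n) ×
  (z ≡ expand (us ++ u ∷ [])) × (digit u ⊗ (ω ^G n) ≡ c)

LeadingTerm : ℕ → GI → Set
LeadingTerm n c = Σ Digit λ u → digit u ⊗ (ω ^G n) ≡ c

Leading : ℕ → GI → GI → Set
Leading n z c = LeadingTerm n c × Σ GI λ w → Expansion n w × w ⊕ c ≡ z

leading⇒expansion : ∀ {n z c} → Leading n z c → LeadingExpansion n z c
leading⇒expansion {n} {z} {c} ((u , uωⁿ≡c) , w , w∈ , w⊕c≡z) =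
  let us , length≡ , expand≡ = expansion⇒digits w∈
  in us , u , length≡ , sym (begin
       expand (us ++ u ∷ [])                 ≡⟨ expandFrom-snoc 0 us u ⟩
       expand us ⊕ digit u ⊗ ω ^G length us  ≡⟨ cong₂ _⊕_ expand≡ (trans (cong (λ m → digit u ⊗ ω ^G m) length≡) uωⁿ≡c) ⟩
       w ⊕ c                                 ≡⟨ w⊕c≡z ⟩
       z                                     ∎) , uωⁿ≡c
  where open ≡-Reasoning

leading-mul-i : ∀ {n z c} → Leading n z c → Leading n (mul-i z) (mul-i c)
leading-mul-i {n} {z} {c} ((u , uωⁿ≡c) , w , w∈ , w⊕c≡z) =
  (di ·ᵈ u , term) , mul-i w , Expansion-mul-i w∈ , trans (mul-i-⊕ w c) (cong mul-i w⊕c≡z)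
  where
  open ≡-Reasoning
  term : digit (di ·ᵈ u) ⊗ ω ^G n ≡ mul-i c
  term = begin
    digit (di ·ᵈ u) ⊗ ω ^G n         ≡⟨ cong (_⊗ ω ^G n) (digit-·ᵈ di u) ⟩
    (digit di ⊗ digit u) ⊗ ω ^G n    ≡⟨ ⊗-assoc (digit di) (digit u) (ω ^G n) ⟩
    digit di ⊗ (digit u ⊗ ω ^G n)    ≡⟨ cong (digit di ⊗_) uωⁿ≡c ⟩
    digit di ⊗ c                     ≡⟨ digit-i⊗ c ⟩
    mul-i c                          ∎

leading-mul-i^ : ∀ t {n z c} → Leading n z c → Leading n (mul-i^ t z) (mul-i^ t c)
leading-mul-i^ zero    ℓ = ℓ
leading-mul-i^ (suc t) ℓ = leading-mul-i (leading-mul-i^ t ℓ)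

leading-turn : ∀ t {n z w c} → mul-i^ t w ≡ z → Leading n w c → Leading n z (mul-i^ t c)
leading-turn t w↻≡z ℓ = subst (λ x → Leading _ x _) w↻≡z (leading-mul-i^ t ℓ)

-- (1+i)² = 2i, so multiplying the digit by −i turns 2^k(1+i) into 2^(k+1)(1+i).
leading-term : ∀ k → LeadingTerm (suc (double k)) (gi (+ (2 ^ k)) (+ (2 ^ k)))
leading-term zero    = d1 , refl
leading-term (suc k) with leading-term k
... | u , uX≡ = d-i ·ᵈ u , (begin
  digit (d-i ·ᵈ u) ⊗ (ω ⊗ (ω ⊗ X))       ≡⟨ cong (_⊗ (ω ⊗ (ω ⊗ X))) (digit-·ᵈ d-i u) ⟩
  (-i ⊗ U) ⊗ (ω ⊗ (ω ⊗ X))               ≡⟨ cong ((-i ⊗ U) ⊗_) (⊗-assoc ω ω X) ⟨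
  (-i ⊗ U) ⊗ ((ω ⊗ ω) ⊗ X)               ≡⟨ ⊗-assoc -i U ((ω ⊗ ω) ⊗ X) ⟩
  -i ⊗ (U ⊗ ((ω ⊗ ω) ⊗ X))               ≡⟨ cong (-i ⊗_) (⊗-left-comm U (ω ⊗ ω) X) ⟩
  -i ⊗ ((ω ⊗ ω) ⊗ (U ⊗ X))               ≡⟨ ⊗-assoc -i (ω ⊗ ω) (U ⊗ X) ⟨
  gi (+ 2) (+ 0) ⊗ (U ⊗ X)               ≡⟨ cong (gi (+ 2) (+ 0) ⊗_) uX≡ ⟩
  gi (+ 2) (+ 0) ⊗ gi P P                ≡⟨ twice P ⟩
  gi (+ 2 * P) (+ 2 * P)                 ≡⟨ cong (λ x → gi x x) (+2^suc k) ⟨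
  gi (+ (2 ^ suc k)) (+ (2 ^ suc k))     ∎)
  where
  open ≡-Reasoning
  -i U X : GI
  -i = digit d-i
  U = digit u
  X = ω ^G suc (double k)
  P : ℤ
  P = + (2 ^ k)
  twice : ∀ P → gi (+ 2) (+ 0) ⊗ gi P P ≡ gi (+ 2 * P) (+ 2 * P)
  twice P = cong₂ gi (re-twice P) (im-twice P)
    where
    re-twice : ∀ P → + 2 * P - + 0 * P ≡ + 2 * P
    re-twice = solve-∀
    im-twice : ∀ P → + 2 * P + + 0 * P ≡ + 2 * P
    im-twice = solve-∀

first-quadrant : ∀ k z → z ≢ 0G → Expansion (suc (suc (2 ℕ.* k))) z → + 0 ≤ re z → + 0 ≤ im z →
  Leading (suc (2 ℕ.* k)) z (gi (+ (2 ^ k)) (+ (2 ^ k)))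
first-quadrant k (gi a b) z≢0 z∈ 0≤a 0≤b =
  subst (λ n → Leading (suc n) (gi a b) (gi P P)) (double≡2* k)
    (leading-term k , gi (a - P) (b - P) , expansion-shift-quadrant k a b z∈′ z≢0 0≤a 0≤b ,
     cong₂ gi (cancel a P) (cancel b P))
  where
  P : ℤ
  P = + (2 ^ k)
  z∈′ : Expansion (suc (suc (double k))) (gi a b)
  z∈′ = subst (λ n → Expansion (suc (suc n)) (gi a b)) (sym (double≡2* k)) z∈
  cancel : ∀ x P → x - P + P ≡ x
  cancel = solve-∀

lemma4p2 : ∀ (a b : ℤ) (k : ℕ) → ¬ ((gi a b) ≡ 0G) →
    MinEuclidVal (gi a b) (suc (2 Data.Nat.* k)) →
    ((+ 0 ≤ a) → (+ 0 ≤ b) →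
      Σ (List Digit) λ us → Σ Digit λ u → (length us ≡ suc (2 Data.Nat.* k)) ×
        ((gi a b) ≡ expand (us ++ (u ∷ []))) ×
        (digit u ⊗ (ω ^G suc (2 Data.Nat.* k)) ≡ gi (+ (2 ^ k)) (+ (2 ^ k)))) ×
    ((a ≤ + 0) → (b ≤ + 0) →
      Σ (List Digit) λ us → Σ Digit λ u → (length us ≡ suc (2 Data.Nat.* k)) ×
        ((gi a b) ≡ expand (us ++ (u ∷ []))) ×
        (digit u ⊗ (ω ^G suc (2 Data.Nat.* k)) ≡ gi (- (+ (2 ^ k))) (- (+ (2 ^ k))))) ×
    ((+ 0 ≤ a) → (b ≤ + 0) →
      Σ (List Digit) λ us → Σ Digit λ u → (length us ≡ suc (2 Data.Nat.* k)) ×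
        ((gi a b) ≡ expand (us ++ (u ∷ []))) ×
        (digit u ⊗ (ω ^G suc (2 Data.Nat.* k)) ≡ gi (+ (2 ^ k)) (- (+ (2 ^ k))))) ×
    ((a ≤ + 0) → (+ 0 ≤ b) →
      Σ (List Digit) λ us → Σ Digit λ u → (length us ≡ suc (2 Data.Nat.* k)) ×
        ((gi a b) ≡ expand (us ++ (u ∷ []))) ×
        (digit u ⊗ (ω ^G suc (2 Data.Nat.* k)) ≡ gi (- (+ (2 ^ k))) (+ (2 ^ k))))
lemma4p2 a b k z≢0 ((_ , euclidean , fz≡2k+1) , _) =
  (λ 0≤a 0≤b → leading 0 0 refl 0≤a 0≤b) ,
  (λ a≤0 b≤0 → leading 2 2 (mul-i^4 z) (ℤP.neg-mono-≤ a≤0) (ℤP.neg-mono-≤ b≤0)) ,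
  (λ 0≤a b≤0 → subst (LeadingExpansion _ z) (cong (λ x → gi x (- P)) (ℤP.neg-involutive P))
                 (leading 1 3 (mul-i^4 z) (ℤP.neg-mono-≤ b≤0) 0≤a)) ,
  (λ a≤0 0≤b → leading 3 1 (mul-i^4 z) (subst (+ 0 ≤_) (sym (ℤP.neg-involutive b)) 0≤b) (ℤP.neg-mono-≤ a≤0))
  where
  z : GI
  z = gi a b
  P : ℤ
  P = + (2 ^ k)
  z∈ : Expansion (suc (suc (2 ℕ.* k))) z
  z∈ = euclidean⇒expansion euclidean _ z z≢0 (subst (ℕ._< _) (sym fz≡2k+1) (ℕP.n<1+n _))
  leading : ∀ s t → mul-i^ t (mul-i^ s z) ≡ z → + 0 ≤ re (mul-i^ s z) → + 0 ≤ im (mul-i^ s z) →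
    LeadingExpansion (suc (2 ℕ.* k)) z (mul-i^ t (gi P P))
  leading s t turn 0≤re 0≤im =
    leading⇒expansion (leading-turn t turn (first-quadrant k _ (mul-i^-≢0 s z≢0) (Expansion-mul-i^ s z∈) 0≤re 0≤im))
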